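{- For every odd integer \(m\ge 3\), the directed Cayley digraph \[ D_7(m)=\operatorname{Cay}\bigl((\mathbb Z_m)^7,\{e_0,e_1,\ldots,e_6\}\bigr) \] admits a directed Hamilton decomposition, i.e. its arc set can be partitioned into (seven) arc-disjoint directed Hamilton cycles.
   Context: \(e_0,\ldots,e_6\) denote the standard basis vectors of \((\mathbb Z_m)^7\). The Cayley digraph \(\operatorname{Cay}((\mathbb Z_m)^7,\{e_0,\ldots,e_6\})\) has vertex set \((\mathbb Z_m)^7\) and an arc \(x\to x+e_i\) for every vertex \(x\) and every \(i\in\{0,\ldots,6\}\). A directed Hamilton decomposition of a digraph is a partition of its arc set into directed Hamilton cycles. -}

module Defs where

open import Data.Nat using (ℕ; zero; suc; _^_)
open import Data.Nat.DivMod using (_%_; m%n<n)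
open import Data.Fin using (Fin; toℕ; fromℕ<)
open import Data.Vec using (Vec; updateAt)
open import Data.Product using (Σ; _×_; _,_; proj₁; proj₂; ∃)
open import Function using (_∘_)
open import Function.Definitions using (Injective)
open import Relation.Binary.PropositionalEquality using (_≡_)

next : ∀ {m} → Fin m → Fin m
next {zero} ()
next {suc n} k = fromℕ< (m%n<n (suc (toℕ k)) (suc n))

Vertex : ℕ → ℕ → Set
Vertex m d = Vec (Fin m) d

_+e_ : ∀ {m d} → Vertex m d → Fin d → Vertex m d
x +e i = updateAt x i next

-- arcs of Cay((ℤ_m)^d, {e_0,...,e_{d-1}}): the arc x → x + e_i is the pair (x , i)
Arc : ℕ → ℕ → Set
Arc m d = Vertex m d × Fin d

tail : ∀ {m d} → Arc m d → Vertex m d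
tail = proj₁

head : ∀ {m d} → Arc m d → Vertex m d
head (x , i) = x +e i

-- A directed Hamilton cycle of D_d(m), given as the cyclic sequence of its
-- m^d arcs: consecutive arcs are incident (head of arc k = tail of arc k+1,
-- indices mod m^d) and the tails are pairwise distinct (so, as there are
-- exactly m^d vertices, every vertex is visited exactly once).
record HamiltonCycle (m d : ℕ) : Set where
  field
    arc         : Fin (m ^ d) → Arc m d
    consecutive : ∀ k → tail (arc (next k)) ≡ head (arc k)
    distinct    : Injective _≡_ _≡_ (tail ∘ arc)

open HamiltonCycle public

-- A directed Hamilton decomposition: a finite family of Hamilton cycles
-- such that every arc of the digraph lies on exactly one position of exactly
-- one cycle (so the arc sets of the cycles partition the arc set).
HamiltonDecomposition : ℕ → ℕ → Set
HamiltonDecomposition m d =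
  Σ ℕ λ r → Σ (Fin r → HamiltonCycle m d) λ C →
    ∀ (a : Arc m d) →
      Σ (Σ (Fin r) λ j → Fin (m ^ d)) λ p →
        arc (C (proj₁ p)) (proj₂ p) ≡ a ×
        (∀ (q : Σ (Fin r) λ j → Fin (m ^ d)) → arc (C (proj₁ q)) (proj₂ q) ≡ a → q ≡ p)

{-# OPTIONS --safe #-}
-- Colour c is the walk from the origin that, at a vertex x, steps in the
-- direction `rule₇ c q`, where q records which of the coordinates y₁, …, y₆ of
-- y = L x are 0, 1 or neither, for the linear forms L listed in `rows₇`.  For
-- every q the seven colours take the seven directions once each, so the walks
-- share no arc.  In the coordinates y each walk is a triangular map: y_j grows
-- by an amount that depends only on the kinds of y₁, …, y_(j−1).  Such a map
-- runs through all of (ℤ_m)^7 in a single cycle as soon as, at every level,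
-- the total increment over one cycle of the lower levels is a unit mod m.  That
-- total counts the residues of the lower coordinates with weights 1, 1, m − 2
-- according to their kind, so mod m it equals the same count with weights
-- 1, 1, −2, which evaluates to ±2^e: a unit because m is odd.  Counting then
-- shows that L is injective and that each walk is a Hamilton cycle.

module Submission where

open import Data.Bool using (Bool; true; T; not; _∧_; _∨_)
open import Data.Bool.Properties using (T-∧; T-∨)
open import Data.Empty using (⊥-elim)
open import Data.Fin as Fin using (Fin; toℕ; fromℕ<; funToFin; finToFun; punchOut)
open import Data.Fin.Patterns
import Data.Fin.Permutation as Perm
import Data.Fin.Properties as Finₚ
open import Data.Integer as ℤ using (ℤ; ∣_∣)
import Data.Integer.Properties as ℤₚ
open import Data.Integer.Divisibility.Signed as ℤ∣ using (∣ᵤ⇒∣; ∣⇒∣ᵤ)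
  renaming (_∣_ to _∣ℤ_)
open import Data.Integer.Tactic.RingSolver using (solve-∀)
open import Data.Nat
open import Data.Nat.Coprimality using (Coprime; 1-coprimeTo; coprime-+; coprime-divisor)
open import Data.Nat.DivMod
open import Data.Nat.Divisibility using (_∣_; divides; ∣m+n∣m⇒∣n; n∣m*n; >⇒∤)
open import Data.Nat.Logarithm using (⌊log₂_⌋; ⌊log₂[2^n]⌋≡n)
open import Data.Nat.Properties
open import Algebra.Properties.CommutativeSemigroup +-commutativeSemigroup
  using (xy∙z≈xz∙y)
open import Algebra.Properties.CommutativeSemigroup *-commutativeSemigroup
  using (x∙yz≈y∙xz)
open import Algebra.Properties.CommutativeMonoid.Sum +-0-commutativeMonoid
  using (sum; ∑-comm; sum-cong-≗; sum-permute)
open import Data.Product as Product using (∃; _×_; _,_; proj₁; proj₂)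
open import Data.Sum using (inj₁; inj₂)
open import Data.Unit using (⊤; tt)
open import Data.Vec using (Vec; []; _∷_; lookup; replicate; tabulate; map)
import Data.Vec.Properties as Vecₚ
open import Function using (_∘_; const)
open import Function.Bundles using (Equivalence)
open import Function.Definitions using (Injective)
open import Relation.Binary.PropositionalEquality
open import Relation.Nullary using (Dec; yes; no)
open import Relation.Nullary.Decidable using (map′; _×-dec_; isYes; toWitness; toWitnessFalse)

open import Defs

open ≡-Reasoning

injective⇒surjective : ∀ {n} {f : Fin n → Fin n} → Injective _≡_ _≡_ f → ∀ y → ∃ λ x → f x ≡ y
injective⇒surjective {suc n} {f} f-inj y with Finₚ.any? (λ x → f x Finₚ.≟ y)
... | yes found = found
... | no  missed = ⊥-elim (Finₚ.<⇒notInjective ≤-refl f∖y-injective)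
  where
  f∖y : Fin (suc n) → Fin n
  f∖y x = punchOut (missed ∘ (x ,_) ∘ sym)
  f∖y-injective : Injective _≡_ _≡_ f∖y
  f∖y-injective {x} {x′} eq = f-inj (Finₚ.punchOut-injective {i = y}
    (missed ∘ (x ,_) ∘ sym) (missed ∘ (x′ ,_) ∘ sym) eq)

∑< : ℕ → (ℕ → ℕ) → ℕ
∑< n f = sum {n} (f ∘ toℕ)

∑<-cong : ∀ n {f g : ℕ → ℕ} → f ≗ g → ∑< n f ≡ ∑< n g
∑<-cong n f≗g = sum-cong-≗ {n} (f≗g ∘ toℕ)

∑<-comm : ∀ a b (f : ℕ → ℕ → ℕ) →
          ∑< a (λ i → ∑< b (f i)) ≡ ∑< b (λ j → ∑< a (λ i → f i j))
∑<-comm a b f = ∑-comm {a} {b} (λ i j → f (toℕ i) (toℕ j))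

∑<-const : ∀ n c → ∑< n (const c) ≡ n * c
∑<-const zero    c = refl
∑<-const (suc n) c = cong (c +_) (∑<-const n c)

∑<-suc : ∀ n f → ∑< (suc n) f ≡ ∑< n f + f n
∑<-suc zero    f = +-identityʳ (f 0)
∑<-suc (suc n) f = trans (cong (f 0 +_) (∑<-suc n (f ∘ suc))) (sym (+-assoc (f 0) _ _))

∑<-+ : ∀ a b f → ∑< (a + b) f ≡ ∑< a f + ∑< b (λ i → f (a + i))
∑<-+ zero    b f = refl
∑<-+ (suc a) b f = trans (cong (f 0 +_) (∑<-+ a b (f ∘ suc))) (sym (+-assoc (f 0) _ _))

∑<-* : ∀ q N f → ∑< (q * N) f ≡ ∑< q (λ i → ∑< N (λ r → f (i * N + r)))
∑<-* zero    N f = refl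
∑<-* (suc q) N f = begin
  ∑< (N + q * N) f                                          ≡⟨ ∑<-+ N (q * N) f ⟩
  ∑< N f + ∑< (q * N) (λ i → f (N + i))                     ≡⟨ cong (∑< N f +_) (∑<-* q N (λ i → f (N + i))) ⟩
  ∑< N f + ∑< q (λ i → ∑< N (λ r → f (N + (i * N + r))))   ≡⟨ cong (∑< N f +_) (∑<-cong q λ i →
                                                               ∑<-cong N λ r → cong f (sym (+-assoc N (i * N) r))) ⟩
  ∑< (suc q) (λ i → ∑< N (λ r → f (i * N + r)))            ∎

∑<-permute : ∀ n (π : ℕ → ℕ) → (∀ {i} → i < n → π i < n) →
             (∀ {i j} → i < n → j < n → π i ≡ π j → i ≡ j) →
             ∀ f → ∑< n (f ∘ π) ≡ ∑< n f
∑<-permute n π π-< π-inj f = begin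
  ∑< n (f ∘ π)                                   ≡⟨ sum-cong-≗ {n} (cong f ∘ sym ∘ toℕ-πᶠ) ⟩
  sum (f ∘ toℕ ∘ πᶠ)                             ≡⟨ sum-permute (f ∘ toℕ) σ ⟨
  ∑< n f                                         ∎
  where
  πᶠ : Fin n → Fin n
  πᶠ i = fromℕ< (π-< (Finₚ.toℕ<n i))
  toℕ-πᶠ : ∀ i → toℕ (πᶠ i) ≡ π (toℕ i)
  toℕ-πᶠ i = Finₚ.toℕ-fromℕ< _
  πᶠ-injective : Injective _≡_ _≡_ πᶠ
  πᶠ-injective {i} {j} eq = Finₚ.toℕ-injective (π-inj (Finₚ.toℕ<n i) (Finₚ.toℕ<n j)
    (trans (sym (toℕ-πᶠ i)) (trans (cong toℕ eq) (toℕ-πᶠ j))))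
  σ : Perm.Permutation n n
  σ = Perm.permutation πᶠ (proj₁ ∘ onto) (proj₂ ∘ onto) (λ i → πᶠ-injective (proj₂ (onto (πᶠ i))))
    where
    onto : ∀ j → ∃ λ i → πᶠ i ≡ j
    onto = injective⇒surjective πᶠ-injective

Periodic : ∀ {A : Set} → ℕ → (ℕ → A) → Set
Periodic N f = ∀ t → f (t + N) ≡ f t

+-suc-* : ∀ t q N → t + suc q * N ≡ t + q * N + N
+-suc-* t q N = trans (cong (t +_) (+-comm N (q * N))) (sym (+-assoc t (q * N) N))

periodic-+* : ∀ {A : Set} {N} {f : ℕ → A} → Periodic N f → ∀ q t → f (t + q * N) ≡ f t
periodic-+* {f = f} f-per zero    t = cong f (+-identityʳ t)
periodic-+* {N = N} {f} f-per (suc q) t =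
  trans (cong f (+-suc-* t q N)) (trans (f-per (t + q * N)) (periodic-+* f-per q t))

periodic-% : ∀ {A : Set} {N} .{{_ : NonZero N}} {f : ℕ → A} → Periodic N f → ∀ t → f (t % N) ≡ f t
periodic-% {N = N} {f} f-per t =
  trans (sym (periodic-+* f-per (t / N) (t % N))) (cong f (sym (m≡m%n+[m/n]*n t N)))

∑<-periodic : ∀ {N f} → Periodic N f → ∀ t → ∑< (t + N) f ≡ ∑< t f + ∑< N f
∑<-periodic             f-per zero    = refl
∑<-periodic {N} {f} f-per (suc t) = begin
  ∑< (suc (t + N)) f               ≡⟨ ∑<-suc (t + N) f ⟩
  ∑< (t + N) f + f (t + N)         ≡⟨ cong₂ _+_ (∑<-periodic f-per t) (f-per t) ⟩
  ∑< t f + ∑< N f + f t            ≡⟨ xy∙z≈xz∙y (∑< t f) _ _ ⟩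
  ∑< t f + f t + ∑< N f            ≡⟨ cong (_+ ∑< N f) (∑<-suc t f) ⟨
  ∑< (suc t) f + ∑< N f            ∎

∑<-+*-periodic : ∀ {N f} → Periodic N f → ∀ q t → ∑< (t + q * N) f ≡ ∑< t f + q * ∑< N f
∑<-+*-periodic {N} {f} f-per zero    t =
  trans (cong (λ s → ∑< s f) (+-identityʳ t)) (sym (+-identityʳ _))
∑<-+*-periodic {N} {f} f-per (suc q) t = begin
  ∑< (t + suc q * N) f             ≡⟨ cong (λ s → ∑< s f) (+-suc-* t q N) ⟩
  ∑< (t + q * N + N) f             ≡⟨ ∑<-periodic f-per (t + q * N) ⟩
  ∑< (t + q * N) f + ∑< N f        ≡⟨ cong (_+ ∑< N f) (∑<-+*-periodic f-per q t) ⟩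
  ∑< t f + q * ∑< N f + ∑< N f     ≡⟨ +-assoc (∑< t f) _ _ ⟩
  ∑< t f + (q * ∑< N f + ∑< N f)   ≡⟨ cong (∑< t f +_) (+-comm (q * ∑< N f) _) ⟩
  ∑< t f + suc q * ∑< N f          ∎

toℕ-next : ∀ {n} .{{_ : NonZero n}} (k : Fin n) → toℕ (next k) ≡ suc (toℕ k) % n
toℕ-next {suc n} k = Finₚ.toℕ-fromℕ< _

encode : ∀ {m d} → Vertex m d → Fin (m ^ d)
encode x = funToFin (lookup x)

decode : ∀ {m d} → Fin (m ^ d) → Vertex m d
decode k = tabulate (finToFun k)

decode-encode : ∀ {m d} (x : Vertex m d) → decode (encode x) ≡ x
decode-encode x = trans (Vecₚ.tabulate-cong (Finₚ.finToFun-funToFin (lookup x))) (Vecₚ.tabulate∘lookup x)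

encode-injective : ∀ {m d} → Injective _≡_ _≡_ (encode {m} {d})
encode-injective {x = x} {y} eq = trans (sym (decode-encode x)) (trans (cong decode eq) (decode-encode y))

injective⇒covers-vertices : ∀ {m d} {f : Fin (m ^ d) → Vertex m d} → Injective _≡_ _≡_ f →
                            ∀ x → ∃ λ k → f k ≡ x
injective⇒covers-vertices f-inj x =
  Product.map₂ encode-injective (injective⇒surjective (f-inj ∘ encode-injective) (encode x))

data Kind : Set where
  k0 k1 k2 : Kind

kind : ℕ → Kind
kind 0             = k0
kind 1             = k1
kind (suc (suc _)) = k2

-- A triangular map of (ℤ_m)^n (applied by `Orbits.step`) adds to each coordinate
-- an amount that depends only on the kinds of the coordinates before it.  Points
-- are nested to the left, so the last coordinate is the top level.

Point : ℕ → Set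
Point zero    = ⊤
Point (suc n) = Point n × ℕ

Kinds : ℕ → Set
Kinds zero    = ⊤
Kinds (suc n) = Kinds n × Kind

kinds : ∀ {n} → Point n → Kinds n
kinds {zero}  _       = tt
kinds {suc n} (p , y) = kinds p , kind y

Triangular : ℕ → Set
Triangular zero    = ⊤
Triangular (suc n) = Triangular n × (Kinds n → ℕ)

column : ∀ {n d} → Vec (Vec ℕ d) n → Fin d → Vec ℕ n
column rows i = map (λ a → lookup a i) rows

IsTriangular : ∀ {n d} → Vec (Vec ℕ d) n → (Kinds n → Fin d) → Set
IsTriangular []       δ = ⊤
IsTriangular (a ∷ as) δ = (∀ q k → column (a ∷ as) (δ (q , k)) ≡ column (a ∷ as) (δ (q , k0)))
                        × IsTriangular as (λ q → δ (q , k0))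

triangularise : ∀ {n d} → Vec (Vec ℕ d) n → (Kinds n → Fin d) → Triangular n
triangularise []       δ = tt
triangularise (a ∷ as) δ = triangularise as (λ q → δ (q , k0)) , (λ q → lookup a (δ (q , k0)))

-- `Orbits.kindSum` with the weight m − 2 replaced by −2, which is congruent
-- to it mod m and makes the sum independent of m.
kindSumℤ : ∀ n → (Kinds n → ℤ) → ℤ
kindSumℤ zero    H = H tt
kindSumℤ (suc n) H = kindSumℤ n (λ q → H (q , k0) ℤ.+ H (q , k1) ℤ.- ℤ.+ 2 ℤ.* H (q , k2))

IsPowerOfTwo : ℕ → Set
IsPowerOfTwo n = ∃ λ e → n ≡ 2 ^ e

powerOfTwo? : ∀ n → Dec (IsPowerOfTwo n)
powerOfTwo? n = map′ (⌊log₂ n ⌋ ,_) exponent (n ≟ 2 ^ ⌊log₂ n ⌋)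
  where
  exponent : IsPowerOfTwo n → n ≡ 2 ^ ⌊log₂ n ⌋
  exponent (e , refl) = cong (2 ^_) (sym (⌊log₂[2^n]⌋≡n e))

PowerOfTwoWeights : ∀ {n} → Triangular n → Set
PowerOfTwoWeights {zero}  _       = ⊤
PowerOfTwoWeights {suc n} (τ , g) = PowerOfTwoWeights τ × IsPowerOfTwo ∣ kindSumℤ n (ℤ.+_ ∘ g) ∣

powerOfTwoWeights? : ∀ {n} (τ : Triangular n) → Dec (PowerOfTwoWeights τ)
powerOfTwoWeights? {zero}  _       = yes tt
powerOfTwoWeights? {suc n} (τ , g) = powerOfTwoWeights? τ ×-dec powerOfTwo? _

-- The finite checks below are Boolean folds rather than `Dec` combinators:
-- they run over up to 3⁷ kind patterns during type checking, where the
-- folds are many times faster.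

allKind : (Kind → Bool) → Bool
allKind f = f k0 ∧ f k1 ∧ f k2

allKind-sound : ∀ f → T (allKind f) → ∀ k → T (f k)
allKind-sound f t k0 = proj₁ (Equivalence.to (T-∧ {f k0}) t)
allKind-sound f t k1 = proj₁ (Equivalence.to (T-∧ {f k1}) (proj₂ (Equivalence.to (T-∧ {f k0}) t)))
allKind-sound f t k2 = proj₂ (Equivalence.to (T-∧ {f k1}) (proj₂ (Equivalence.to (T-∧ {f k0}) t)))

allKinds : ∀ n → (Kinds n → Bool) → Bool
allKinds zero    f = f tt
allKinds (suc n) f = allKinds n λ q → allKind λ k → f (q , k)

allKinds-sound : ∀ n f → T (allKinds n f) → ∀ q → T (f q)
allKinds-sound zero    f t _       = t
allKinds-sound (suc n) f t (q , k) = allKind-sound (λ k → f (q , k)) (allKinds-sound n _ t q) k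

allFin : ∀ n → (Fin n → Bool) → Bool
allFin zero    f = true
allFin (suc n) f = f 0F ∧ allFin n (f ∘ Fin.suc)

allFin-sound : ∀ n f → T (allFin n f) → ∀ i → T (f i)
allFin-sound (suc n) f t 0F          = proj₁ (Equivalence.to (T-∧ {f 0F}) t)
allFin-sound (suc n) f t (Fin.suc i) = allFin-sound n (f ∘ Fin.suc) (proj₂ (Equivalence.to (T-∧ {f 0F}) t)) i

injectiveᵇ : ∀ {n k} → (Fin n → Fin k) → Bool
injectiveᵇ {n} f = allFin n λ c → allFin n λ c′ → not (isYes (f c Finₚ.≟ f c′)) ∨ isYes (c Finₚ.≟ c′)

injectiveᵇ-sound : ∀ {n k} (f : Fin n → Fin k) → T (injectiveᵇ f) → Injective _≡_ _≡_ f
injectiveᵇ-sound {n} f t {c} {c′} eq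
  with Equivalence.to (T-∨ {not (isYes (f c Finₚ.≟ f c′))}) (allFin-sound n _ (allFin-sound n _ t c) c′)
... | inj₁ f-differ = ⊥-elim (toWitnessFalse {a? = f c Finₚ.≟ f c′} f-differ eq)
... | inj₂ c≡c′     = toWitness {a? = c Finₚ.≟ c′} c≡c′

sameColumnᵇ : ∀ {n d} → Vec (Vec ℕ d) n → Fin d → Fin d → Bool
sameColumnᵇ rows i j = isYes (i Finₚ.≟ j) ∨ isYes (Vecₚ.≡-dec _≟_ (column rows i) (column rows j))

sameColumnᵇ-sound : ∀ {n d} (rows : Vec (Vec ℕ d) n) i j → T (sameColumnᵇ rows i j) → column rows i ≡ column rows j
sameColumnᵇ-sound rows i j t with Equivalence.to (T-∨ {isYes (i Finₚ.≟ j)}) t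
... | inj₁ i≡j  = cong (column rows) (toWitness {a? = i Finₚ.≟ j} i≡j)
... | inj₂ same = toWitness {a? = Vecₚ.≡-dec _≟_ (column rows i) (column rows j)} same

triangularᵇ : ∀ {n d} → Vec (Vec ℕ d) n → (Kinds n → Fin d) → Bool
triangularᵇ []               δ = true
triangularᵇ {suc n} (a ∷ as) δ =
  allKinds n (λ q → allKind λ k → sameColumnᵇ (a ∷ as) (δ (q , k)) (δ (q , k0))) ∧ triangularᵇ as (λ q → δ (q , k0))

triangularᵇ-sound : ∀ {n d} (rows : Vec (Vec ℕ d) n) δ → T (triangularᵇ rows δ) → IsTriangular rows δ
triangularᵇ-sound []               δ _ = tt
triangularᵇ-sound {suc n} (a ∷ as) δ t =
  (λ q k → sameColumnᵇ-sound (a ∷ as) _ _ (allKind-sound (same q) (allKinds-sound n (allKind ∘ same) (proj₁ t∧) q) k)) ,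
  triangularᵇ-sound as _ (proj₂ t∧)
  where
  same : Kinds n → Kind → Bool
  same q k = sameColumnᵇ (a ∷ as) (δ (q , k)) (δ (q , k0))
  t∧ : T (allKinds n (allKind ∘ same)) × T (triangularᵇ as (λ q → δ (q , k0)))
  t∧ = Equivalence.to (T-∧ {allKinds n (allKind ∘ same)}) t

module Residues (m′ : ℕ) where

  m : ℕ
  m = 2 + m′

  +-congʳ-% : ∀ a b c → b % m ≡ c % m → (a + b) % m ≡ (a + c) % m
  +-congʳ-% a b c eq = begin
    (a + b) % m              ≡⟨ %-distribˡ-+ a b m ⟩
    (a % m + b % m) % m      ≡⟨ cong (λ z → (a % m + z) % m) eq ⟩
    (a % m + c % m) % m      ≡⟨ %-distribˡ-+ a c m ⟨
    (a + c) % m              ∎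

  +-congˡ-% : ∀ a b c → a % m ≡ b % m → (a + c) % m ≡ (b + c) % m
  +-congˡ-% a b c eq =
    trans (cong (_% m) (+-comm a c)) (trans (+-congʳ-% c a b eq) (cong (_% m) (+-comm c b)))

  *-congʳ-% : ∀ a b c → b % m ≡ c % m → (a * b) % m ≡ (a * c) % m
  *-congʳ-% a b c eq = begin
    (a * b) % m              ≡⟨ %-distribˡ-* a b m ⟩
    (a % m * (b % m)) % m    ≡⟨ cong (λ z → (a % m * z) % m) eq ⟩
    (a % m * (c % m)) % m    ≡⟨ %-distribˡ-* a c m ⟨
    (a * c) % m              ∎

  [x+y]%m≡x%m⇒m∣y : ∀ x y → (x + y) % m ≡ x % m → m ∣ y
  [x+y]%m≡x%m⇒m∣y x y eq = ∣m+n∣m⇒∣n (divides ((x + y) / m) (+-cancelˡ-≡ (x % m) _ _ split)) (n∣m*n (x / m))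
    where
    split : x % m + (x / m * m + y) ≡ x % m + (x + y) / m * m
    split = begin
      x % m + (x / m * m + y)      ≡⟨ +-assoc (x % m) _ y ⟨
      x % m + x / m * m + y        ≡⟨ cong (_+ y) (m≡m%n+[m/n]*n x m) ⟨
      x + y                        ≡⟨ m≡m%n+[m/n]*n (x + y) m ⟩
      (x + y) % m + (x + y) / m * m ≡⟨ cong (_+ (x + y) / m * m) eq ⟩
      x % m + (x + y) / m * m      ∎

  Cancellative : ℕ → Set
  Cancellative G = ∀ k → m ∣ k * G → m ∣ k

  private
    ∣∧<⇒≡0 : ∀ {d} → m ∣ d → d < m → d ≡ 0
    ∣∧<⇒≡0 {zero}  _   _   = refl
    ∣∧<⇒≡0 {suc d} m∣d d<m = ⊥-elim (>⇒∤ d<m m∣d)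

    cancel-≤ : ∀ {G} → Cancellative G → ∀ a {q q′} → q ≤ q′ → q′ < m →
               (a + q′ * G) % m ≡ (a + q * G) % m → q′ ≡ q
    cancel-≤ {G} cancel a {q} {q′} q≤q′ q′<m eq = begin
      q′            ≡⟨ m∸n+n≡m q≤q′ ⟨
      q′ ∸ q + q    ≡⟨ cong (_+ q) (∣∧<⇒≡0 (cancel (q′ ∸ q) m∣dG) (≤-<-trans (m∸n≤m q′ q) q′<m)) ⟩
      q             ∎
      where
      a+q′G≡a+qG+dG : a + q′ * G ≡ a + q * G + (q′ ∸ q) * G
      a+q′G≡a+qG+dG = begin
        a + q′ * G                 ≡⟨ cong (λ z → a + z * G) (trans (sym (m∸n+n≡m q≤q′)) (+-comm (q′ ∸ q) q)) ⟩
        a + (q + (q′ ∸ q)) * G     ≡⟨ cong (a +_) (*-distribʳ-+ G q (q′ ∸ q)) ⟩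
        a + (q * G + (q′ ∸ q) * G) ≡⟨ +-assoc a _ _ ⟨
        a + q * G + (q′ ∸ q) * G   ∎
      m∣dG : m ∣ (q′ ∸ q) * G
      m∣dG = [x+y]%m≡x%m⇒m∣y (a + q * G) _ (trans (cong (_% m) (sym a+q′G≡a+qG+dG)) eq)

  +*-cancel-% : ∀ {G} → Cancellative G → ∀ a {q q′} → q < m → q′ < m →
                (a + q * G) % m ≡ (a + q′ * G) % m → q ≡ q′
  +*-cancel-% cancel a {q} {q′} q<m q′<m eq with ≤-total q q′
  ... | inj₁ q≤q′ = sym (cancel-≤ cancel a q≤q′ q′<m (sym eq))
  ... | inj₂ q′≤q = cancel-≤ cancel a q′≤q q<m eq

  ∑<-kind : ∀ (F : Kind → ℕ) → ∑< m (F ∘ kind) ≡ F k0 + F k1 + m′ * F k2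
  ∑<-kind F = trans (cong (λ s → F k0 + (F k1 + s)) (∑<-const m′ (F k2))) (sym (+-assoc (F k0) _ _))

  ∑<-kind-affine : ∀ {G} → Cancellative G → ∀ a (F : Kind → ℕ) →
                   ∑< m (λ q → F (kind ((a + q * G) % m))) ≡ F k0 + F k1 + m′ * F k2
  ∑<-kind-affine {G} cancel a F =
    trans (∑<-permute m (λ q → (a + q * G) % m) (λ {q} _ → m%n<n (a + q * G) m) (+*-cancel-% cancel a) (F ∘ kind))
          (∑<-kind F)

  odd⇒coprime-2 : m % 2 ≡ 1 → Coprime m 2
  odd⇒coprime-2 odd = subst (λ n → Coprime n 2) (sym m≡1+2j) (1+2j-coprime (m / 2))
    where
    m≡1+2j : m ≡ 1 + m / 2 * 2
    m≡1+2j = trans (m≡m%n+[m/n]*n m 2) (cong (_+ m / 2 * 2) odd)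
    1+2j-coprime : ∀ j → Coprime (1 + j * 2) 2
    1+2j-coprime zero    = 1-coprimeTo 2
    1+2j-coprime (suc j) = coprime-+ (1+2j-coprime j)

  coprime-2⇒cancel-2^ : Coprime m 2 → ∀ e {k} → m ∣ k * 2 ^ e → m ∣ k
  coprime-2⇒cancel-2^ cop zero    {k} m∣k*1 = subst (m ∣_) (*-identityʳ k) m∣k*1
  coprime-2⇒cancel-2^ cop (suc e) {k} m∣k*2^[1+e] =
    coprime-2⇒cancel-2^ cop e (coprime-divisor cop (subst (m ∣_) (x∙yz≈y∙xz k 2 (2 ^ e)) m∣k*2^[1+e]))

module Orbits (m′ : ℕ) where

  open Residues m′

  step : ∀ {n} → Triangular n → Point n → Point n
  step {zero}  _       _       = tt
  step {suc n} (τ , g) (p , y) = step τ p , (y + g (kinds p)) % m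

  orbit : ∀ {n} → Triangular n → ℕ → Point n
  orbit {zero}  _       _ = tt
  orbit {suc n} (τ , g) t = orbit τ t , ∑< t (g ∘ kinds ∘ orbit τ) % m

  orbit-suc : ∀ {n} (τ : Triangular n) t → orbit τ (suc t) ≡ step τ (orbit τ t)
  orbit-suc {zero}  _       _ = refl
  orbit-suc {suc n} (τ , g) t = cong₂ _,_ (orbit-suc τ t) (begin
    ∑< (suc t) f % m          ≡⟨ cong (_% m) (∑<-suc t f) ⟩
    (∑< t f + f t) % m        ≡⟨ +-congˡ-% (∑< t f % m) (∑< t f) (f t) (m%n%n≡m%n (∑< t f) m) ⟨
    (∑< t f % m + f t) % m    ∎)
    where
    f : ℕ → ℕ
    f = g ∘ kinds ∘ orbit τ

  -- The sum of H ∘ kinds over all of (ℤ_m)^n: in each coordinate one residue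
  -- has kind k0, one has kind k1 and the other m − 2 have kind k2.
  kindSum : ∀ n → (Kinds n → ℕ) → ℕ
  kindSum zero    H = H tt
  kindSum (suc n) H = kindSum n (λ q → H (q , k0) + H (q , k1) + m′ * H (q , k2))

  Admissible : ∀ {n} → Triangular n → Set
  Admissible {zero}  _       = ⊤
  Admissible {suc n} (τ , g) = Admissible τ × Cancellative (kindSum n g)

  record FullCycle {n} (τ : Triangular n) : Set where
    field
      periodic  : Periodic (m ^ n) (orbit τ)
      injective : ∀ {t t′} → t < m ^ n → t′ < m ^ n → orbit τ t ≡ orbit τ t′ → t ≡ t′
      ∑-orbit   : ∀ H → ∑< (m ^ n) (H ∘ kinds ∘ orbit τ) ≡ kindSum n H

  -- Over one period N of the lower levels the top coordinate advances by
  -- G = kindSum n g, so the orbit closes after exactly m periods when G is a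
  -- unit mod m.
  module NextLevel {n} {τ : Triangular n} (full : FullCycle τ)
                   (g : Kinds n → ℕ) (cancel : Cancellative (kindSum n g)) where

    open FullCycle full

    N : ℕ
    N = m ^ n

    instance
      N≢0 : NonZero N
      N≢0 = m^n≢0 m n

    height : ℕ → ℕ
    height t = ∑< t (g ∘ kinds ∘ orbit τ)

    G : ℕ
    G = height N

    G-cancellative : Cancellative G
    G-cancellative = subst Cancellative (sym (∑-orbit g)) cancel

    orbit-+* : ∀ t q → orbit (τ , g) (t + q * N) ≡ (orbit τ t , (height t + q * G) % m)
    orbit-+* t q = cong₂ _,_ (periodic-+* periodic q t)
                             (cong (_% m) (∑<-+*-periodic {N} {g ∘ kinds ∘ orbit τ} (cong (g ∘ kinds) ∘ periodic) q t))

    orbit-% : ∀ t → orbit (τ , g) t ≡ (orbit τ (t % N) , (height (t % N) + t / N * G) % m)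
    orbit-% t = trans (cong (orbit (τ , g)) (m≡m%n+[m/n]*n t N)) (orbit-+* (t % N) (t / N))

    periodic′ : Periodic (m * N) (orbit (τ , g))
    periodic′ t = trans (orbit-+* t m) (cong (orbit τ t ,_) (begin
      (height t + m * G) % m     ≡⟨ cong (λ z → (height t + z) % m) (*-comm m G) ⟩
      (height t + G * m) % m     ≡⟨ [m+kn]%n≡m%n (height t) G m ⟩
      height t % m               ∎))

    injective′ : ∀ {t t′} → t < m * N → t′ < m * N → orbit (τ , g) t ≡ orbit (τ , g) t′ → t ≡ t′
    injective′ {t} {t′} t<mN t′<mN eq = begin
      t                     ≡⟨ m≡m%n+[m/n]*n t N ⟩
      t % N + t / N * N     ≡⟨ cong₂ (λ r q → r + q * N) r≡r′ q≡q′ ⟩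
      t′ % N + t′ / N * N   ≡⟨ m≡m%n+[m/n]*n t′ N ⟨
      t′                    ∎
      where
      eq′ : (orbit τ (t % N) , (height (t % N) + t / N * G) % m)
          ≡ (orbit τ (t′ % N) , (height (t′ % N) + t′ / N * G) % m)
      eq′ = trans (sym (orbit-% t)) (trans eq (orbit-% t′))
      r≡r′ : t % N ≡ t′ % N
      r≡r′ = injective (m%n<n t N) (m%n<n t′ N) (cong proj₁ eq′)
      q≡q′ : t / N ≡ t′ / N
      q≡q′ = +*-cancel-% G-cancellative (height (t % N)) (m<n*o⇒m/o<n t<mN) (m<n*o⇒m/o<n t′<mN)
               (trans (cong proj₂ eq′) (cong (λ r → (height r + t′ / N * G) % m) (sym r≡r′)))

    ∑-orbit′ : ∀ H → ∑< (m * N) (H ∘ kinds ∘ orbit (τ , g)) ≡ kindSum (suc n) H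
    ∑-orbit′ H = begin
      ∑< (m * N) (H ∘ kinds ∘ orbit (τ , g))
        ≡⟨ ∑<-* m N (H ∘ kinds ∘ orbit (τ , g)) ⟩
      ∑< m (λ q → ∑< N (λ r → H (kinds (orbit (τ , g) (q * N + r)))))
        ≡⟨ ∑<-cong m (λ q → ∑<-cong N (λ r → cong (H ∘ kinds)
             (trans (cong (orbit (τ , g)) (+-comm (q * N) r)) (orbit-+* r q)))) ⟩
      ∑< m (λ q → ∑< N (λ r → H (kinds (orbit τ r) , kind ((height r + q * G) % m))))
        ≡⟨ ∑<-comm m N (λ q r → H (kinds (orbit τ r) , kind ((height r + q * G) % m))) ⟩
      ∑< N (λ r → ∑< m (λ q → H (kinds (orbit τ r) , kind ((height r + q * G) % m))))
        ≡⟨ ∑<-cong N (λ r → ∑<-kind-affine G-cancellative (height r) (λ k → H (kinds (orbit τ r) , k))) ⟩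
      ∑< N (λ r → H′ (kinds (orbit τ r)))
        ≡⟨ ∑-orbit H′ ⟩
      kindSum (suc n) H ∎
      where
      H′ : Kinds n → ℕ
      H′ q = H (q , k0) + H (q , k1) + m′ * H (q , k2)

    fullCycle : FullCycle (τ , g)
    fullCycle = record { periodic = periodic′ ; injective = injective′ ; ∑-orbit = ∑-orbit′ }

  admissible⇒fullCycle : ∀ {n} (τ : Triangular n) → Admissible τ → FullCycle τ
  admissible⇒fullCycle {zero} τ _ = record
    { periodic  = λ _ → refl
    ; injective = λ t<1 t′<1 _ → trans (n<1⇒n≡0 t<1) (sym (n<1⇒n≡0 t′<1))
    ; ∑-orbit   = λ H → +-identityʳ (H tt)
    }
  admissible⇒fullCycle {suc n} (τ , g) (admissible , cancel) =
    NextLevel.fullCycle (admissible⇒fullCycle τ admissible) g cancel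

  kindSum≡kindSumℤ : ∀ n (H : Kinds n → ℕ) (H′ : Kinds n → ℤ) → (∀ q → ℤ.+ m ∣ℤ ℤ.+ H q ℤ.- H′ q) →
                     ℤ.+ m ∣ℤ ℤ.+ kindSum n H ℤ.- kindSumℤ n H′
  kindSum≡kindSumℤ zero    H H′ H≡H′ = H≡H′ tt
  kindSum≡kindSumℤ (suc n) H H′ H≡H′ =
    kindSum≡kindSumℤ n _ _ λ q → combine _ _ _ (H′ (q , k0)) (H′ (q , k1)) (H′ (q , k2))
      (H≡H′ (q , k0)) (H≡H′ (q , k1)) (H≡H′ (q , k2))
    where
    combine : ∀ a b c a′ b′ c′ → ℤ.+ m ∣ℤ ℤ.+ a ℤ.- a′ → ℤ.+ m ∣ℤ ℤ.+ b ℤ.- b′ → ℤ.+ m ∣ℤ ℤ.+ c ℤ.- c′ →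
              ℤ.+ m ∣ℤ ℤ.+ (a + b + m′ * c) ℤ.- (a′ ℤ.+ b′ ℤ.- ℤ.+ 2 ℤ.* c′)
    combine a b c a′ b′ c′ a≡a′ b≡b′ c≡c′ = subst (ℤ.+ m ∣ℤ_) (sym split)
      (ℤ∣.∣m∣n⇒∣m+n (ℤ∣.∣m∣n⇒∣m+n (ℤ∣.∣m∣n⇒∣m+n a≡a′ b≡b′) (ℤ∣.∣n⇒∣m*n (ℤ.+ m′) c≡c′))
                    (ℤ∣.∣m⇒∣m*n c′ ℤ∣.∣-refl))
      where
      regroup : ∀ A B C A′ B′ C′ M′ →
                A ℤ.+ B ℤ.+ M′ ℤ.* C ℤ.- (A′ ℤ.+ B′ ℤ.- ℤ.+ 2 ℤ.* C′)
                ≡ A ℤ.- A′ ℤ.+ (B ℤ.- B′) ℤ.+ M′ ℤ.* (C ℤ.- C′) ℤ.+ (ℤ.+ 2 ℤ.+ M′) ℤ.* C′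
      regroup = solve-∀
      split : ℤ.+ (a + b + m′ * c) ℤ.- (a′ ℤ.+ b′ ℤ.- ℤ.+ 2 ℤ.* c′)
              ≡ ℤ.+ a ℤ.- a′ ℤ.+ (ℤ.+ b ℤ.- b′) ℤ.+ ℤ.+ m′ ℤ.* (ℤ.+ c ℤ.- c′) ℤ.+ ℤ.+ m ℤ.* c′
      split = trans (cong (ℤ._- _) (trans (ℤₚ.pos-+ (a + b) (m′ * c))
                                   (cong₂ ℤ._+_ (ℤₚ.pos-+ a b) (ℤₚ.pos-* m′ c))))
                    (regroup (ℤ.+ a) (ℤ.+ b) (ℤ.+ c) a′ b′ c′ (ℤ.+ m′))

  ≡±2^⇒cancellative : Coprime m 2 → ∀ {G w} e → ℤ.+ m ∣ℤ ℤ.+ G ℤ.- w → ∣ w ∣ ≡ 2 ^ e → Cancellative G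
  ≡±2^⇒cancellative cop {G} {w} e G≡w ∣w∣≡2^e k m∣kG =
    coprime-2⇒cancel-2^ cop e (subst (m ∣_) ∣kw∣≡k2^e (∣⇒∣ᵤ m∣kw))
    where
    kw≡kG-k[G-w] : ∀ K G W → K ℤ.* W ≡ K ℤ.* G ℤ.- K ℤ.* (G ℤ.- W)
    kw≡kG-k[G-w] = solve-∀
    m∣kw : ℤ.+ m ∣ℤ ℤ.+ k ℤ.* w
    m∣kw = subst (ℤ.+ m ∣ℤ_) (sym (kw≡kG-k[G-w] (ℤ.+ k) (ℤ.+ G) w))
      (ℤ∣.∣m∣n⇒∣m-n (∣ᵤ⇒∣ {i = ℤ.+ k ℤ.* ℤ.+ G} (subst (m ∣_) (cong ∣_∣ (ℤₚ.pos-* k G)) m∣kG))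
                    (ℤ∣.∣n⇒∣m*n (ℤ.+ k) G≡w))
    ∣kw∣≡k2^e : ∣ ℤ.+ k ℤ.* w ∣ ≡ k * 2 ^ e
    ∣kw∣≡k2^e = trans (ℤₚ.abs-* (ℤ.+ k) w) (cong (k *_) ∣w∣≡2^e)

  powerOfTwoWeights⇒admissible : Coprime m 2 → ∀ {n} (τ : Triangular n) → PowerOfTwoWeights τ → Admissible τ
  powerOfTwoWeights⇒admissible cop {zero}  _       _              = tt
  powerOfTwoWeights⇒admissible cop {suc n} (τ , g) (weights , e , ∣w∣≡2^e) =
    powerOfTwoWeights⇒admissible cop τ weights ,
    ≡±2^⇒cancellative cop {w = kindSumℤ n (ℤ.+_ ∘ g)} e
      (kindSum≡kindSumℤ n g (ℤ.+_ ∘ g) (λ q → ℤ∣.divides (ℤ.+ 0) (ℤₚ.+-inverseʳ (ℤ.+ g q))))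
      ∣w∣≡2^e

module Coordinates (m′ : ℕ) where

  open Residues m′
  open Orbits m′

  evaluate : ∀ {d} → Vec ℕ d → Vertex m d → ℕ
  evaluate []       []       = 0
  evaluate (a ∷ as) (y ∷ ys) = a * toℕ y + evaluate as ys

  evaluate-origin : ∀ {d} (a : Vec ℕ d) → evaluate a (replicate d Fin.zero) ≡ 0
  evaluate-origin []       = refl
  evaluate-origin (a ∷ as) = cong₂ _+_ (*-zeroʳ a) (evaluate-origin as)

  evaluate-+e : ∀ {d} (a : Vec ℕ d) x i → evaluate a (x +e i) % m ≡ (evaluate a x + lookup a i) % m
  evaluate-+e (a ∷ as) (y ∷ ys) Fin.zero = begin
    (a * toℕ (next y) + R) % m       ≡⟨ +-congˡ-% (a * toℕ (next y)) (a * suc (toℕ y)) R (*-congʳ-% a _ _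
                                          (trans (cong (_% m) (toℕ-next y)) (m%n%n≡m%n (suc (toℕ y)) m))) ⟩
    (a * suc (toℕ y) + R) % m        ≡⟨ cong (λ z → (z + R) % m) (*-suc a (toℕ y)) ⟩
    (a + a * toℕ y + R) % m          ≡⟨ cong (_% m) (trans (+-assoc a _ R) (+-comm a _)) ⟩
    (a * toℕ y + R + a) % m          ∎
    where
    R : ℕ
    R = evaluate as ys
  evaluate-+e (a ∷ as) (y ∷ ys) (Fin.suc i) = begin
    (a * toℕ y + evaluate as (ys +e i)) % m           ≡⟨ +-congʳ-% (a * toℕ y) _ _ (evaluate-+e as ys i) ⟩
    (a * toℕ y + (evaluate as ys + lookup as i)) % m  ≡⟨ cong (_% m) (+-assoc (a * toℕ y) _ _) ⟨
    (a * toℕ y + evaluate as ys + lookup as i) % m    ∎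

  coordinates : ∀ {n d} → Vec (Vec ℕ d) n → Vertex m d → Point n
  coordinates []       x = tt
  coordinates (a ∷ as) x = coordinates as x , evaluate a x % m

  shift : ∀ {n d} → Vec (Vec ℕ d) n → Fin d → Point n → Point n
  shift []       i _       = tt
  shift (a ∷ as) i (p , y) = shift as i p , (y + lookup a i) % m

  coordinates-origin : ∀ {n d} (rows : Vec (Vec ℕ d) n) (τ : Triangular n) →
                       coordinates rows (replicate d Fin.zero) ≡ orbit τ 0
  coordinates-origin []       _       = refl
  coordinates-origin (a ∷ as) (τ , _) = cong₂ _,_ (coordinates-origin as τ) (cong (_% m) (evaluate-origin a))

  coordinates-+e : ∀ {n d} (rows : Vec (Vec ℕ d) n) x i →
                   coordinates rows (x +e i) ≡ shift rows i (coordinates rows x)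
  coordinates-+e []       x i = refl
  coordinates-+e (a ∷ as) x i = cong₂ _,_ (coordinates-+e as x i)
    (trans (evaluate-+e a x i)
           (+-congˡ-% (evaluate a x) (evaluate a x % m) (lookup a i) (sym (m%n%n≡m%n (evaluate a x) m))))

  shift-cong : ∀ {n d} (rows : Vec (Vec ℕ d) n) {i j} → column rows i ≡ column rows j →
               ∀ p → shift rows i p ≡ shift rows j p
  shift-cong []       _  _       = refl
  shift-cong (a ∷ as) eq (p , y) = cong₂ _,_ (shift-cong as (Vecₚ.∷-injectiveʳ eq) p)
                                             (cong (λ z → (y + z) % m) (Vecₚ.∷-injectiveˡ eq))

  shift≡step : ∀ {n d} (rows : Vec (Vec ℕ d) n) {δ} → IsTriangular rows δ →
               ∀ p → shift rows (δ (kinds p)) p ≡ step (triangularise rows δ) p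
  shift≡step []       _                   _       = refl
  shift≡step (a ∷ as) {δ} (top-free , tri) (p , y) = begin
    shift (a ∷ as) (δ (kinds p , kind y)) (p , y)   ≡⟨ shift-cong (a ∷ as) (top-free (kinds p) (kind y)) (p , y) ⟩
    shift (a ∷ as) (δ (kinds p , k0)) (p , y)       ≡⟨ cong (_, _) (shift≡step as tri p) ⟩
    step (triangularise (a ∷ as) δ) (p , y)         ∎

module Walks (m′ : ℕ) {d} (rows : Vec (Vec ℕ d) d) (rule : Fin d → Kinds d → Fin d)
             (triangular : ∀ c → IsTriangular rows (rule c))
             (admissible : ∀ c → Orbits.Admissible m′ (triangularise rows (rule c)))
             (rule-injective : ∀ q → Injective _≡_ _≡_ (λ c → rule c q)) where

  open Residues m′
  open Orbits m′
  open Coordinates m′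

  N : ℕ
  N = m ^ d

  instance
    N≢0 : NonZero N
    N≢0 = m^n≢0 m d

  direction : Fin d → Vertex m d → Fin d
  direction c x = rule c (kinds (coordinates rows x))

  walk : Fin d → ℕ → Vertex m d
  walk c zero    = replicate d Fin.zero
  walk c (suc t) = walk c t +e direction c (walk c t)

  module Colour (c : Fin d) where

    τ : Triangular d
    τ = triangularise rows (rule c)

    open FullCycle (admissible⇒fullCycle τ (admissible c))

    coordinates-walk : ∀ t → coordinates rows (walk c t) ≡ orbit τ t
    coordinates-walk zero    = coordinates-origin rows τ
    coordinates-walk (suc t) = begin
      coordinates rows (walk c t +e direction c (walk c t))      ≡⟨ coordinates-+e rows (walk c t) _ ⟩
      shift rows (direction c (walk c t)) (coordinates rows (walk c t)) ≡⟨ shift≡step rows (triangular c) _ ⟩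
      step τ (coordinates rows (walk c t))                       ≡⟨ cong (step τ) (coordinates-walk t) ⟩
      step τ (orbit τ t)                                         ≡⟨ orbit-suc τ t ⟨
      orbit τ (suc t)                                            ∎

    walk-injective : ∀ {t t′} → t < N → t′ < N → walk c t ≡ walk c t′ → t ≡ t′
    walk-injective t<N t′<N eq = injective t<N t′<N
      (trans (sym (coordinates-walk _)) (trans (cong (coordinates rows) eq) (coordinates-walk _)))

    walk-surjective : ∀ x → ∃ λ (k : Fin N) → walk c (toℕ k) ≡ x
    walk-surjective = injective⇒covers-vertices
      (Finₚ.toℕ-injective ∘ walk-injective (Finₚ.toℕ<n _) (Finₚ.toℕ<n _))

    coordinates-injective : ∀ {x x′} → coordinates rows x ≡ coordinates rows x′ → x ≡ x′
    coordinates-injective {x} {x′} eq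
      with k , refl ← walk-surjective x | k′ , refl ← walk-surjective x′ =
      cong (walk c) (injective (Finₚ.toℕ<n k) (Finₚ.toℕ<n k′)
        (trans (sym (coordinates-walk _)) (trans eq (coordinates-walk _))))

    walk-periodic : Periodic N (walk c)
    walk-periodic zero    = coordinates-injective
      (trans (coordinates-walk N) (trans (periodic 0) (sym (coordinates-walk 0))))
    walk-periodic (suc t) = cong (λ x → x +e direction c x) (walk-periodic t)

    hamiltonCycle : HamiltonCycle m d
    hamiltonCycle = record
      { arc         = λ k → walk c (toℕ k) , direction c (walk c (toℕ k))
      ; consecutive = λ k → trans (cong (walk c) (toℕ-next k)) (periodic-% walk-periodic (suc (toℕ k)))
      ; distinct    = Finₚ.toℕ-injective ∘ walk-injective (Finₚ.toℕ<n _) (Finₚ.toℕ<n _)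
      }

  open Colour using (hamiltonCycle; walk-injective; walk-surjective)

  hamiltonDecomposition : HamiltonDecomposition m d
  hamiltonDecomposition = d , hamiltonCycle , λ a → position a , arc-at-position a , position-unique a
    where
    colour : Arc m d → Fin d
    colour (x , i) = proj₁ (injective⇒surjective (rule-injective (kinds (coordinates rows x))) i)

    colour-direction : ∀ x i → direction (colour (x , i)) x ≡ i
    colour-direction x i = proj₂ (injective⇒surjective (rule-injective (kinds (coordinates rows x))) i)

    position : Arc m d → Fin d × Fin N
    position (x , i) = colour (x , i) , proj₁ (walk-surjective (colour (x , i)) x)

    arc-at-position : ∀ a → arc (hamiltonCycle (proj₁ (position a))) (proj₂ (position a)) ≡ a
    arc-at-position (x , i) =
      cong₂ _,_ on-walk (trans (cong (direction (colour (x , i))) on-walk) (colour-direction x i))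
      where
      on-walk : walk (colour (x , i)) (toℕ (proj₂ (position (x , i)))) ≡ x
      on-walk = proj₂ (walk-surjective (colour (x , i)) x)

    position-unique : ∀ a p → arc (hamiltonCycle (proj₁ p)) (proj₂ p) ≡ a → p ≡ position a
    position-unique (x , i) (c , k) eq = cong₂ _,_ c≡colour k≡position
      where
      on-walk : walk c (toℕ k) ≡ x
      on-walk = cong proj₁ eq
      c≡colour : c ≡ colour (x , i)
      c≡colour = rule-injective (kinds (coordinates rows x))
        (trans (trans (cong (direction c) (sym on-walk)) (cong proj₂ eq)) (sym (colour-direction x i)))
      k≡position : k ≡ proj₂ (position (x , i))
      k≡position = Finₚ.toℕ-injective (walk-injective (colour (x , i)) (Finₚ.toℕ<n k) (Finₚ.toℕ<n _)
        (trans (subst (λ c′ → walk c′ (toℕ k) ≡ x) c≡colour on-walk)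
               (sym (proj₂ (walk-surjective (colour (x , i)) x)))))

-- The linear forms y₇, …, y₁ (top level first) as coefficient rows over x₀, …, x₆.
rows₇ : Vec (Vec ℕ 7) 7
rows₇ =
  (0 ∷ 0 ∷ 0 ∷ 0 ∷ 0 ∷ 0 ∷ 1 ∷ []) ∷
  (0 ∷ 0 ∷ 0 ∷ 0 ∷ 1 ∷ 0 ∷ 0 ∷ []) ∷
  (0 ∷ 0 ∷ 1 ∷ 0 ∷ 0 ∷ 0 ∷ 0 ∷ []) ∷
  (0 ∷ 0 ∷ 0 ∷ 0 ∷ 0 ∷ 1 ∷ 1 ∷ []) ∷
  (0 ∷ 1 ∷ 1 ∷ 0 ∷ 0 ∷ 0 ∷ 0 ∷ []) ∷
  (0 ∷ 0 ∷ 0 ∷ 1 ∷ 1 ∷ 1 ∷ 1 ∷ []) ∷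
  (1 ∷ 1 ∷ 1 ∷ 1 ∷ 1 ∷ 1 ∷ 1 ∷ []) ∷ []

-- `table κ₁ … κ₆` lists the directions of colours 0, …, 6 at the vertices
-- whose coordinates y₁, …, y₆ have kinds κ₁, …, κ₆.
table : Kind → Kind → Kind → Kind → Kind → Kind → Vec (Fin 7) 7
table k0 k0 k0 k0 k0 k0 = 4F ∷ 1F ∷ 2F ∷ 5F ∷ 3F ∷ 6F ∷ 0F ∷ []
table k0 k0 k0 k0 k0 k1 = 4F ∷ 1F ∷ 2F ∷ 6F ∷ 3F ∷ 5F ∷ 0F ∷ []
table k0 k0 k0 k0 k0 k2 = 4F ∷ 1F ∷ 2F ∷ 5F ∷ 3F ∷ 6F ∷ 0F ∷ []
table k0 k0 k0 k0 k1 k0 = 4F ∷ 1F ∷ 2F ∷ 6F ∷ 3F ∷ 5F ∷ 0F ∷ []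
table k0 k0 k0 k0 k1 k1 = 4F ∷ 1F ∷ 2F ∷ 5F ∷ 3F ∷ 6F ∷ 0F ∷ []
table k0 k0 k0 k0 k1 k2 = 4F ∷ 1F ∷ 2F ∷ 6F ∷ 3F ∷ 5F ∷ 0F ∷ []
table k0 k0 k0 k0 k2 k0 = 3F ∷ 1F ∷ 2F ∷ 6F ∷ 4F ∷ 5F ∷ 0F ∷ []
table k0 k0 k0 k0 k2 k1 = 3F ∷ 1F ∷ 2F ∷ 5F ∷ 4F ∷ 6F ∷ 0F ∷ []
table k0 k0 k0 k0 k2 k2 = 3F ∷ 1F ∷ 2F ∷ 5F ∷ 4F ∷ 6F ∷ 0F ∷ []
table k0 k0 k0 k1 k0 k0 = 4F ∷ 1F ∷ 2F ∷ 5F ∷ 3F ∷ 6F ∷ 0F ∷ []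
table k0 k0 k0 k1 k0 k1 = 4F ∷ 1F ∷ 2F ∷ 5F ∷ 3F ∷ 6F ∷ 0F ∷ []
table k0 k0 k0 k1 k0 k2 = 4F ∷ 1F ∷ 2F ∷ 5F ∷ 3F ∷ 6F ∷ 0F ∷ []
table k0 k0 k0 k1 k1 k0 = 4F ∷ 1F ∷ 2F ∷ 5F ∷ 3F ∷ 6F ∷ 0F ∷ []
table k0 k0 k0 k1 k1 k1 = 4F ∷ 1F ∷ 2F ∷ 6F ∷ 3F ∷ 5F ∷ 0F ∷ []
table k0 k0 k0 k1 k1 k2 = 4F ∷ 1F ∷ 2F ∷ 5F ∷ 3F ∷ 6F ∷ 0F ∷ []
table k0 k0 k0 k1 k2 k0 = 3F ∷ 1F ∷ 2F ∷ 5F ∷ 4F ∷ 6F ∷ 0F ∷ []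
table k0 k0 k0 k1 k2 k1 = 3F ∷ 1F ∷ 2F ∷ 5F ∷ 4F ∷ 6F ∷ 0F ∷ []
table k0 k0 k0 k1 k2 k2 = 3F ∷ 1F ∷ 2F ∷ 6F ∷ 4F ∷ 5F ∷ 0F ∷ []
table k0 k0 k0 k2 k0 k0 = 3F ∷ 1F ∷ 2F ∷ 6F ∷ 4F ∷ 5F ∷ 0F ∷ []
table k0 k0 k0 k2 k0 k1 = 3F ∷ 1F ∷ 2F ∷ 5F ∷ 4F ∷ 6F ∷ 0F ∷ []
table k0 k0 k0 k2 k0 k2 = 3F ∷ 1F ∷ 2F ∷ 5F ∷ 4F ∷ 6F ∷ 0F ∷ []
table k0 k0 k0 k2 k1 k0 = 3F ∷ 1F ∷ 2F ∷ 6F ∷ 4F ∷ 5F ∷ 0F ∷ []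
table k0 k0 k0 k2 k1 k1 = 3F ∷ 1F ∷ 2F ∷ 6F ∷ 4F ∷ 5F ∷ 0F ∷ []
table k0 k0 k0 k2 k1 k2 = 3F ∷ 1F ∷ 2F ∷ 5F ∷ 4F ∷ 6F ∷ 0F ∷ []
table k0 k0 k0 k2 k2 k0 = 4F ∷ 1F ∷ 2F ∷ 6F ∷ 3F ∷ 5F ∷ 0F ∷ []
table k0 k0 k0 k2 k2 k1 = 4F ∷ 1F ∷ 2F ∷ 6F ∷ 3F ∷ 5F ∷ 0F ∷ []
table k0 k0 k0 k2 k2 k2 = 4F ∷ 1F ∷ 2F ∷ 6F ∷ 3F ∷ 5F ∷ 0F ∷ []
table k0 k0 k1 k0 k0 k0 = 4F ∷ 2F ∷ 1F ∷ 3F ∷ 5F ∷ 6F ∷ 0F ∷ []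
table k0 k0 k1 k0 k0 k1 = 4F ∷ 2F ∷ 1F ∷ 3F ∷ 6F ∷ 5F ∷ 0F ∷ []
table k0 k0 k1 k0 k0 k2 = 4F ∷ 2F ∷ 1F ∷ 3F ∷ 5F ∷ 6F ∷ 0F ∷ []
table k0 k0 k1 k0 k1 k0 = 3F ∷ 2F ∷ 1F ∷ 4F ∷ 5F ∷ 6F ∷ 0F ∷ []
table k0 k0 k1 k0 k1 k1 = 3F ∷ 2F ∷ 1F ∷ 4F ∷ 6F ∷ 5F ∷ 0F ∷ []
table k0 k0 k1 k0 k1 k2 = 3F ∷ 2F ∷ 1F ∷ 4F ∷ 5F ∷ 6F ∷ 0F ∷ []
table k0 k0 k1 k0 k2 k0 = 3F ∷ 2F ∷ 1F ∷ 4F ∷ 5F ∷ 6F ∷ 0F ∷ []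
table k0 k0 k1 k0 k2 k1 = 3F ∷ 2F ∷ 1F ∷ 4F ∷ 6F ∷ 5F ∷ 0F ∷ []
table k0 k0 k1 k0 k2 k2 = 3F ∷ 2F ∷ 1F ∷ 4F ∷ 5F ∷ 6F ∷ 0F ∷ []
table k0 k0 k1 k1 k0 k0 = 3F ∷ 2F ∷ 1F ∷ 4F ∷ 6F ∷ 5F ∷ 0F ∷ []
table k0 k0 k1 k1 k0 k1 = 3F ∷ 2F ∷ 1F ∷ 4F ∷ 6F ∷ 5F ∷ 0F ∷ []
table k0 k0 k1 k1 k0 k2 = 3F ∷ 2F ∷ 1F ∷ 4F ∷ 6F ∷ 5F ∷ 0F ∷ []
table k0 k0 k1 k1 k1 k0 = 4F ∷ 2F ∷ 1F ∷ 3F ∷ 6F ∷ 5F ∷ 0F ∷ []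
table k0 k0 k1 k1 k1 k1 = 4F ∷ 2F ∷ 1F ∷ 3F ∷ 5F ∷ 6F ∷ 0F ∷ []
table k0 k0 k1 k1 k1 k2 = 4F ∷ 2F ∷ 1F ∷ 3F ∷ 5F ∷ 6F ∷ 0F ∷ []
table k0 k0 k1 k1 k2 k0 = 3F ∷ 2F ∷ 1F ∷ 4F ∷ 5F ∷ 6F ∷ 0F ∷ []
table k0 k0 k1 k1 k2 k1 = 3F ∷ 2F ∷ 1F ∷ 4F ∷ 6F ∷ 5F ∷ 0F ∷ []
table k0 k0 k1 k1 k2 k2 = 3F ∷ 2F ∷ 1F ∷ 4F ∷ 5F ∷ 6F ∷ 0F ∷ []
table k0 k0 k1 k2 k0 k0 = 3F ∷ 2F ∷ 1F ∷ 4F ∷ 6F ∷ 5F ∷ 0F ∷ []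
table k0 k0 k1 k2 k0 k1 = 3F ∷ 2F ∷ 1F ∷ 4F ∷ 5F ∷ 6F ∷ 0F ∷ []
table k0 k0 k1 k2 k0 k2 = 3F ∷ 2F ∷ 1F ∷ 4F ∷ 5F ∷ 6F ∷ 0F ∷ []
table k0 k0 k1 k2 k1 k0 = 3F ∷ 2F ∷ 1F ∷ 4F ∷ 5F ∷ 6F ∷ 0F ∷ []
table k0 k0 k1 k2 k1 k1 = 3F ∷ 2F ∷ 1F ∷ 4F ∷ 5F ∷ 6F ∷ 0F ∷ []
table k0 k0 k1 k2 k1 k2 = 3F ∷ 2F ∷ 1F ∷ 4F ∷ 6F ∷ 5F ∷ 0F ∷ []
table k0 k0 k1 k2 k2 k0 = 4F ∷ 2F ∷ 1F ∷ 3F ∷ 5F ∷ 6F ∷ 0F ∷ []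
table k0 k0 k1 k2 k2 k1 = 4F ∷ 2F ∷ 1F ∷ 3F ∷ 6F ∷ 5F ∷ 0F ∷ []
table k0 k0 k1 k2 k2 k2 = 4F ∷ 2F ∷ 1F ∷ 3F ∷ 5F ∷ 6F ∷ 0F ∷ []
table k0 k0 k2 k0 k0 k0 = 5F ∷ 2F ∷ 1F ∷ 3F ∷ 6F ∷ 4F ∷ 0F ∷ []
table k0 k0 k2 k0 k0 k1 = 5F ∷ 2F ∷ 1F ∷ 3F ∷ 6F ∷ 4F ∷ 0F ∷ []
table k0 k0 k2 k0 k0 k2 = 6F ∷ 2F ∷ 1F ∷ 3F ∷ 5F ∷ 4F ∷ 0F ∷ []
table k0 k0 k2 k0 k1 k0 = 5F ∷ 2F ∷ 1F ∷ 3F ∷ 6F ∷ 4F ∷ 0F ∷ []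
table k0 k0 k2 k0 k1 k1 = 6F ∷ 2F ∷ 1F ∷ 3F ∷ 5F ∷ 4F ∷ 0F ∷ []
table k0 k0 k2 k0 k1 k2 = 5F ∷ 2F ∷ 1F ∷ 3F ∷ 6F ∷ 4F ∷ 0F ∷ []
table k0 k0 k2 k0 k2 k0 = 5F ∷ 2F ∷ 1F ∷ 4F ∷ 6F ∷ 3F ∷ 0F ∷ []
table k0 k0 k2 k0 k2 k1 = 5F ∷ 2F ∷ 1F ∷ 4F ∷ 6F ∷ 3F ∷ 0F ∷ []
table k0 k0 k2 k0 k2 k2 = 6F ∷ 2F ∷ 1F ∷ 4F ∷ 5F ∷ 3F ∷ 0F ∷ []
table k0 k0 k2 k1 k0 k0 = 5F ∷ 1F ∷ 2F ∷ 3F ∷ 6F ∷ 4F ∷ 0F ∷ []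
table k0 k0 k2 k1 k0 k1 = 6F ∷ 1F ∷ 2F ∷ 3F ∷ 5F ∷ 4F ∷ 0F ∷ []
table k0 k0 k2 k1 k0 k2 = 5F ∷ 1F ∷ 2F ∷ 3F ∷ 6F ∷ 4F ∷ 0F ∷ []
table k0 k0 k2 k1 k1 k0 = 6F ∷ 1F ∷ 2F ∷ 4F ∷ 5F ∷ 3F ∷ 0F ∷ []
table k0 k0 k2 k1 k1 k1 = 5F ∷ 1F ∷ 2F ∷ 4F ∷ 6F ∷ 3F ∷ 0F ∷ []
table k0 k0 k2 k1 k1 k2 = 5F ∷ 1F ∷ 2F ∷ 4F ∷ 6F ∷ 3F ∷ 0F ∷ []
table k0 k0 k2 k1 k2 k0 = 6F ∷ 1F ∷ 2F ∷ 4F ∷ 5F ∷ 3F ∷ 0F ∷ []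
table k0 k0 k2 k1 k2 k1 = 5F ∷ 1F ∷ 2F ∷ 4F ∷ 6F ∷ 3F ∷ 0F ∷ []
table k0 k0 k2 k1 k2 k2 = 5F ∷ 1F ∷ 2F ∷ 4F ∷ 6F ∷ 3F ∷ 0F ∷ []
table k0 k0 k2 k2 k0 k0 = 6F ∷ 1F ∷ 2F ∷ 3F ∷ 5F ∷ 4F ∷ 0F ∷ []
table k0 k0 k2 k2 k0 k1 = 5F ∷ 1F ∷ 2F ∷ 3F ∷ 6F ∷ 4F ∷ 0F ∷ []
table k0 k0 k2 k2 k0 k2 = 6F ∷ 1F ∷ 2F ∷ 3F ∷ 5F ∷ 4F ∷ 0F ∷ []
table k0 k0 k2 k2 k1 k0 = 6F ∷ 1F ∷ 2F ∷ 3F ∷ 5F ∷ 4F ∷ 0F ∷ []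
table k0 k0 k2 k2 k1 k1 = 5F ∷ 1F ∷ 2F ∷ 3F ∷ 6F ∷ 4F ∷ 0F ∷ []
table k0 k0 k2 k2 k1 k2 = 5F ∷ 1F ∷ 2F ∷ 3F ∷ 6F ∷ 4F ∷ 0F ∷ []
table k0 k0 k2 k2 k2 k0 = 5F ∷ 1F ∷ 2F ∷ 4F ∷ 6F ∷ 3F ∷ 0F ∷ []
table k0 k0 k2 k2 k2 k1 = 6F ∷ 1F ∷ 2F ∷ 4F ∷ 5F ∷ 3F ∷ 0F ∷ []
table k0 k0 k2 k2 k2 k2 = 6F ∷ 1F ∷ 2F ∷ 4F ∷ 5F ∷ 3F ∷ 0F ∷ []
table k0 k1 k0 k0 k0 k0 = 6F ∷ 2F ∷ 0F ∷ 4F ∷ 5F ∷ 3F ∷ 1F ∷ []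
table k0 k1 k0 k0 k0 k1 = 5F ∷ 2F ∷ 0F ∷ 4F ∷ 6F ∷ 3F ∷ 1F ∷ []
table k0 k1 k0 k0 k0 k2 = 6F ∷ 2F ∷ 0F ∷ 4F ∷ 5F ∷ 3F ∷ 1F ∷ []
table k0 k1 k0 k0 k1 k0 = 6F ∷ 2F ∷ 0F ∷ 4F ∷ 5F ∷ 3F ∷ 1F ∷ []
table k0 k1 k0 k0 k1 k1 = 5F ∷ 2F ∷ 0F ∷ 4F ∷ 6F ∷ 3F ∷ 1F ∷ []
table k0 k1 k0 k0 k1 k2 = 5F ∷ 2F ∷ 0F ∷ 4F ∷ 6F ∷ 3F ∷ 1F ∷ []
table k0 k1 k0 k0 k2 k0 = 6F ∷ 2F ∷ 0F ∷ 4F ∷ 5F ∷ 3F ∷ 1F ∷ []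
table k0 k1 k0 k0 k2 k1 = 6F ∷ 2F ∷ 0F ∷ 4F ∷ 5F ∷ 3F ∷ 1F ∷ []
table k0 k1 k0 k0 k2 k2 = 6F ∷ 2F ∷ 0F ∷ 4F ∷ 5F ∷ 3F ∷ 1F ∷ []
table k0 k1 k0 k1 k0 k0 = 5F ∷ 1F ∷ 0F ∷ 3F ∷ 6F ∷ 4F ∷ 2F ∷ []
table k0 k1 k0 k1 k0 k1 = 5F ∷ 1F ∷ 0F ∷ 3F ∷ 6F ∷ 4F ∷ 2F ∷ []
table k0 k1 k0 k1 k0 k2 = 6F ∷ 1F ∷ 0F ∷ 3F ∷ 5F ∷ 4F ∷ 2F ∷ []
table k0 k1 k0 k1 k1 k0 = 5F ∷ 1F ∷ 0F ∷ 4F ∷ 6F ∷ 3F ∷ 2F ∷ []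
table k0 k1 k0 k1 k1 k1 = 5F ∷ 1F ∷ 0F ∷ 4F ∷ 6F ∷ 3F ∷ 2F ∷ []
table k0 k1 k0 k1 k1 k2 = 5F ∷ 1F ∷ 0F ∷ 4F ∷ 6F ∷ 3F ∷ 2F ∷ []
table k0 k1 k0 k1 k2 k0 = 5F ∷ 1F ∷ 0F ∷ 4F ∷ 6F ∷ 3F ∷ 2F ∷ []
table k0 k1 k0 k1 k2 k1 = 6F ∷ 1F ∷ 0F ∷ 4F ∷ 5F ∷ 3F ∷ 2F ∷ []
table k0 k1 k0 k1 k2 k2 = 5F ∷ 1F ∷ 0F ∷ 4F ∷ 6F ∷ 3F ∷ 2F ∷ []
table k0 k1 k0 k2 k0 k0 = 5F ∷ 1F ∷ 0F ∷ 4F ∷ 6F ∷ 3F ∷ 2F ∷ []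
table k0 k1 k0 k2 k0 k1 = 6F ∷ 1F ∷ 0F ∷ 4F ∷ 5F ∷ 3F ∷ 2F ∷ []
table k0 k1 k0 k2 k0 k2 = 5F ∷ 1F ∷ 0F ∷ 4F ∷ 6F ∷ 3F ∷ 2F ∷ []
table k0 k1 k0 k2 k1 k0 = 6F ∷ 1F ∷ 0F ∷ 3F ∷ 5F ∷ 4F ∷ 2F ∷ []
table k0 k1 k0 k2 k1 k1 = 6F ∷ 1F ∷ 0F ∷ 3F ∷ 5F ∷ 4F ∷ 2F ∷ []
table k0 k1 k0 k2 k1 k2 = 6F ∷ 1F ∷ 0F ∷ 3F ∷ 5F ∷ 4F ∷ 2F ∷ []
table k0 k1 k0 k2 k2 k0 = 6F ∷ 1F ∷ 0F ∷ 3F ∷ 5F ∷ 4F ∷ 2F ∷ []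
table k0 k1 k0 k2 k2 k1 = 6F ∷ 1F ∷ 0F ∷ 3F ∷ 5F ∷ 4F ∷ 2F ∷ []
table k0 k1 k0 k2 k2 k2 = 5F ∷ 1F ∷ 0F ∷ 3F ∷ 6F ∷ 4F ∷ 2F ∷ []
table k0 k1 k1 k0 k0 k0 = 5F ∷ 2F ∷ 0F ∷ 3F ∷ 6F ∷ 4F ∷ 1F ∷ []
table k0 k1 k1 k0 k0 k1 = 5F ∷ 2F ∷ 0F ∷ 3F ∷ 6F ∷ 4F ∷ 1F ∷ []
table k0 k1 k1 k0 k0 k2 = 5F ∷ 2F ∷ 0F ∷ 3F ∷ 6F ∷ 4F ∷ 1F ∷ []
table k0 k1 k1 k0 k1 k0 = 5F ∷ 2F ∷ 0F ∷ 3F ∷ 6F ∷ 4F ∷ 1F ∷ []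
table k0 k1 k1 k0 k1 k1 = 6F ∷ 2F ∷ 0F ∷ 3F ∷ 5F ∷ 4F ∷ 1F ∷ []
table k0 k1 k1 k0 k1 k2 = 5F ∷ 2F ∷ 0F ∷ 3F ∷ 6F ∷ 4F ∷ 1F ∷ []
table k0 k1 k1 k0 k2 k0 = 6F ∷ 2F ∷ 0F ∷ 3F ∷ 5F ∷ 4F ∷ 1F ∷ []
table k0 k1 k1 k0 k2 k1 = 5F ∷ 2F ∷ 0F ∷ 3F ∷ 6F ∷ 4F ∷ 1F ∷ []
table k0 k1 k1 k0 k2 k2 = 6F ∷ 2F ∷ 0F ∷ 3F ∷ 5F ∷ 4F ∷ 1F ∷ []
table k0 k1 k1 k1 k0 k0 = 5F ∷ 1F ∷ 0F ∷ 4F ∷ 6F ∷ 3F ∷ 2F ∷ []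
table k0 k1 k1 k1 k0 k1 = 6F ∷ 1F ∷ 0F ∷ 4F ∷ 5F ∷ 3F ∷ 2F ∷ []
table k0 k1 k1 k1 k0 k2 = 5F ∷ 1F ∷ 0F ∷ 4F ∷ 6F ∷ 3F ∷ 2F ∷ []
table k0 k1 k1 k1 k1 k0 = 5F ∷ 1F ∷ 0F ∷ 4F ∷ 6F ∷ 3F ∷ 2F ∷ []
table k0 k1 k1 k1 k1 k1 = 5F ∷ 1F ∷ 0F ∷ 4F ∷ 6F ∷ 3F ∷ 2F ∷ []
table k0 k1 k1 k1 k1 k2 = 6F ∷ 1F ∷ 0F ∷ 4F ∷ 5F ∷ 3F ∷ 2F ∷ []
table k0 k1 k1 k1 k2 k0 = 5F ∷ 1F ∷ 0F ∷ 3F ∷ 6F ∷ 4F ∷ 2F ∷ []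
table k0 k1 k1 k1 k2 k1 = 5F ∷ 1F ∷ 0F ∷ 3F ∷ 6F ∷ 4F ∷ 2F ∷ []
table k0 k1 k1 k1 k2 k2 = 5F ∷ 1F ∷ 0F ∷ 3F ∷ 6F ∷ 4F ∷ 2F ∷ []
table k0 k1 k1 k2 k0 k0 = 6F ∷ 1F ∷ 0F ∷ 4F ∷ 5F ∷ 3F ∷ 2F ∷ []
table k0 k1 k1 k2 k0 k1 = 5F ∷ 1F ∷ 0F ∷ 4F ∷ 6F ∷ 3F ∷ 2F ∷ []
table k0 k1 k1 k2 k0 k2 = 5F ∷ 1F ∷ 0F ∷ 4F ∷ 6F ∷ 3F ∷ 2F ∷ []
table k0 k1 k1 k2 k1 k0 = 5F ∷ 1F ∷ 0F ∷ 4F ∷ 6F ∷ 3F ∷ 2F ∷ []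
table k0 k1 k1 k2 k1 k1 = 5F ∷ 1F ∷ 0F ∷ 4F ∷ 6F ∷ 3F ∷ 2F ∷ []
table k0 k1 k1 k2 k1 k2 = 5F ∷ 1F ∷ 0F ∷ 4F ∷ 6F ∷ 3F ∷ 2F ∷ []
table k0 k1 k1 k2 k2 k0 = 6F ∷ 1F ∷ 0F ∷ 3F ∷ 5F ∷ 4F ∷ 2F ∷ []
table k0 k1 k1 k2 k2 k1 = 5F ∷ 1F ∷ 0F ∷ 3F ∷ 6F ∷ 4F ∷ 2F ∷ []
table k0 k1 k1 k2 k2 k2 = 5F ∷ 1F ∷ 0F ∷ 3F ∷ 6F ∷ 4F ∷ 2F ∷ []
table k0 k1 k2 k0 k0 k0 = 4F ∷ 1F ∷ 0F ∷ 3F ∷ 6F ∷ 5F ∷ 2F ∷ []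
table k0 k1 k2 k0 k0 k1 = 4F ∷ 1F ∷ 0F ∷ 3F ∷ 5F ∷ 6F ∷ 2F ∷ []
table k0 k1 k2 k0 k0 k2 = 4F ∷ 1F ∷ 0F ∷ 3F ∷ 6F ∷ 5F ∷ 2F ∷ []
table k0 k1 k2 k0 k1 k0 = 4F ∷ 1F ∷ 0F ∷ 3F ∷ 6F ∷ 5F ∷ 2F ∷ []
table k0 k1 k2 k0 k1 k1 = 4F ∷ 1F ∷ 0F ∷ 3F ∷ 5F ∷ 6F ∷ 2F ∷ []
table k0 k1 k2 k0 k1 k2 = 4F ∷ 1F ∷ 0F ∷ 3F ∷ 5F ∷ 6F ∷ 2F ∷ []
table k0 k1 k2 k0 k2 k0 = 3F ∷ 1F ∷ 0F ∷ 4F ∷ 5F ∷ 6F ∷ 2F ∷ []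
table k0 k1 k2 k0 k2 k1 = 3F ∷ 1F ∷ 0F ∷ 4F ∷ 6F ∷ 5F ∷ 2F ∷ []
table k0 k1 k2 k0 k2 k2 = 3F ∷ 1F ∷ 0F ∷ 4F ∷ 6F ∷ 5F ∷ 2F ∷ []
table k0 k1 k2 k1 k0 k0 = 4F ∷ 1F ∷ 0F ∷ 3F ∷ 5F ∷ 6F ∷ 2F ∷ []
table k0 k1 k2 k1 k0 k1 = 4F ∷ 1F ∷ 0F ∷ 3F ∷ 6F ∷ 5F ∷ 2F ∷ []
table k0 k1 k2 k1 k0 k2 = 4F ∷ 1F ∷ 0F ∷ 3F ∷ 6F ∷ 5F ∷ 2F ∷ []
table k0 k1 k2 k1 k1 k0 = 4F ∷ 1F ∷ 0F ∷ 3F ∷ 5F ∷ 6F ∷ 2F ∷ []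
table k0 k1 k2 k1 k1 k1 = 4F ∷ 1F ∷ 0F ∷ 3F ∷ 5F ∷ 6F ∷ 2F ∷ []
table k0 k1 k2 k1 k1 k2 = 4F ∷ 1F ∷ 0F ∷ 3F ∷ 6F ∷ 5F ∷ 2F ∷ []
table k0 k1 k2 k1 k2 k0 = 4F ∷ 1F ∷ 0F ∷ 3F ∷ 6F ∷ 5F ∷ 2F ∷ []
table k0 k1 k2 k1 k2 k1 = 4F ∷ 1F ∷ 0F ∷ 3F ∷ 6F ∷ 5F ∷ 2F ∷ []
table k0 k1 k2 k1 k2 k2 = 4F ∷ 1F ∷ 0F ∷ 3F ∷ 6F ∷ 5F ∷ 2F ∷ []
table k0 k1 k2 k2 k0 k0 = 3F ∷ 1F ∷ 0F ∷ 4F ∷ 6F ∷ 5F ∷ 2F ∷ []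
table k0 k1 k2 k2 k0 k1 = 3F ∷ 1F ∷ 0F ∷ 4F ∷ 5F ∷ 6F ∷ 2F ∷ []
table k0 k1 k2 k2 k0 k2 = 3F ∷ 1F ∷ 0F ∷ 4F ∷ 5F ∷ 6F ∷ 2F ∷ []
table k0 k1 k2 k2 k1 k0 = 3F ∷ 1F ∷ 0F ∷ 4F ∷ 6F ∷ 5F ∷ 2F ∷ []
table k0 k1 k2 k2 k1 k1 = 3F ∷ 1F ∷ 0F ∷ 4F ∷ 6F ∷ 5F ∷ 2F ∷ []
table k0 k1 k2 k2 k1 k2 = 3F ∷ 1F ∷ 0F ∷ 4F ∷ 6F ∷ 5F ∷ 2F ∷ []
table k0 k1 k2 k2 k2 k0 = 4F ∷ 1F ∷ 0F ∷ 3F ∷ 5F ∷ 6F ∷ 2F ∷ []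
table k0 k1 k2 k2 k2 k1 = 4F ∷ 1F ∷ 0F ∷ 3F ∷ 6F ∷ 5F ∷ 2F ∷ []
table k0 k1 k2 k2 k2 k2 = 4F ∷ 1F ∷ 0F ∷ 3F ∷ 5F ∷ 6F ∷ 2F ∷ []
table k0 k2 k0 k0 k0 k0 = 6F ∷ 1F ∷ 0F ∷ 4F ∷ 3F ∷ 5F ∷ 2F ∷ []
table k0 k2 k0 k0 k0 k1 = 6F ∷ 1F ∷ 0F ∷ 4F ∷ 3F ∷ 5F ∷ 2F ∷ []
table k0 k2 k0 k0 k0 k2 = 5F ∷ 1F ∷ 0F ∷ 4F ∷ 3F ∷ 6F ∷ 2F ∷ []
table k0 k2 k0 k0 k1 k0 = 6F ∷ 1F ∷ 0F ∷ 4F ∷ 3F ∷ 5F ∷ 2F ∷ []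
table k0 k2 k0 k0 k1 k1 = 5F ∷ 1F ∷ 0F ∷ 4F ∷ 3F ∷ 6F ∷ 2F ∷ []
table k0 k2 k0 k0 k1 k2 = 5F ∷ 1F ∷ 0F ∷ 4F ∷ 3F ∷ 6F ∷ 2F ∷ []
table k0 k2 k0 k0 k2 k0 = 5F ∷ 1F ∷ 0F ∷ 3F ∷ 4F ∷ 6F ∷ 2F ∷ []
table k0 k2 k0 k0 k2 k1 = 6F ∷ 1F ∷ 0F ∷ 3F ∷ 4F ∷ 5F ∷ 2F ∷ []
table k0 k2 k0 k0 k2 k2 = 6F ∷ 1F ∷ 0F ∷ 3F ∷ 4F ∷ 5F ∷ 2F ∷ []
table k0 k2 k0 k1 k0 k0 = 6F ∷ 1F ∷ 0F ∷ 3F ∷ 4F ∷ 5F ∷ 2F ∷ []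
table k0 k2 k0 k1 k0 k1 = 6F ∷ 1F ∷ 0F ∷ 3F ∷ 4F ∷ 5F ∷ 2F ∷ []
table k0 k2 k0 k1 k0 k2 = 5F ∷ 1F ∷ 0F ∷ 3F ∷ 4F ∷ 6F ∷ 2F ∷ []
table k0 k2 k0 k1 k1 k0 = 5F ∷ 1F ∷ 0F ∷ 4F ∷ 3F ∷ 6F ∷ 2F ∷ []
table k0 k2 k0 k1 k1 k1 = 6F ∷ 1F ∷ 0F ∷ 4F ∷ 3F ∷ 5F ∷ 2F ∷ []
table k0 k2 k0 k1 k1 k2 = 5F ∷ 1F ∷ 0F ∷ 4F ∷ 3F ∷ 6F ∷ 2F ∷ []
table k0 k2 k0 k1 k2 k0 = 6F ∷ 1F ∷ 0F ∷ 4F ∷ 3F ∷ 5F ∷ 2F ∷ []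
table k0 k2 k0 k1 k2 k1 = 6F ∷ 1F ∷ 0F ∷ 4F ∷ 3F ∷ 5F ∷ 2F ∷ []
table k0 k2 k0 k1 k2 k2 = 6F ∷ 1F ∷ 0F ∷ 4F ∷ 3F ∷ 5F ∷ 2F ∷ []
table k0 k2 k0 k2 k0 k0 = 5F ∷ 2F ∷ 0F ∷ 4F ∷ 3F ∷ 6F ∷ 1F ∷ []
table k0 k2 k0 k2 k0 k1 = 6F ∷ 2F ∷ 0F ∷ 4F ∷ 3F ∷ 5F ∷ 1F ∷ []
table k0 k2 k0 k2 k0 k2 = 6F ∷ 2F ∷ 0F ∷ 4F ∷ 3F ∷ 5F ∷ 1F ∷ []
table k0 k2 k0 k2 k1 k0 = 5F ∷ 2F ∷ 0F ∷ 3F ∷ 4F ∷ 6F ∷ 1F ∷ []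
table k0 k2 k0 k2 k1 k1 = 5F ∷ 2F ∷ 0F ∷ 3F ∷ 4F ∷ 6F ∷ 1F ∷ []
table k0 k2 k0 k2 k1 k2 = 6F ∷ 2F ∷ 0F ∷ 3F ∷ 4F ∷ 5F ∷ 1F ∷ []
table k0 k2 k0 k2 k2 k0 = 6F ∷ 2F ∷ 0F ∷ 4F ∷ 3F ∷ 5F ∷ 1F ∷ []
table k0 k2 k0 k2 k2 k1 = 6F ∷ 2F ∷ 0F ∷ 4F ∷ 3F ∷ 5F ∷ 1F ∷ []
table k0 k2 k0 k2 k2 k2 = 6F ∷ 2F ∷ 0F ∷ 4F ∷ 3F ∷ 5F ∷ 1F ∷ []
table k0 k2 k1 k0 k0 k0 = 3F ∷ 2F ∷ 0F ∷ 4F ∷ 6F ∷ 5F ∷ 1F ∷ []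
table k0 k2 k1 k0 k0 k1 = 3F ∷ 2F ∷ 0F ∷ 4F ∷ 5F ∷ 6F ∷ 1F ∷ []
table k0 k2 k1 k0 k0 k2 = 3F ∷ 2F ∷ 0F ∷ 4F ∷ 6F ∷ 5F ∷ 1F ∷ []
table k0 k2 k1 k0 k1 k0 = 4F ∷ 2F ∷ 0F ∷ 3F ∷ 6F ∷ 5F ∷ 1F ∷ []
table k0 k2 k1 k0 k1 k1 = 4F ∷ 2F ∷ 0F ∷ 3F ∷ 5F ∷ 6F ∷ 1F ∷ []
table k0 k2 k1 k0 k1 k2 = 4F ∷ 2F ∷ 0F ∷ 3F ∷ 5F ∷ 6F ∷ 1F ∷ []
table k0 k2 k1 k0 k2 k0 = 3F ∷ 2F ∷ 0F ∷ 4F ∷ 5F ∷ 6F ∷ 1F ∷ []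
table k0 k2 k1 k0 k2 k1 = 3F ∷ 2F ∷ 0F ∷ 4F ∷ 5F ∷ 6F ∷ 1F ∷ []
table k0 k2 k1 k0 k2 k2 = 3F ∷ 2F ∷ 0F ∷ 4F ∷ 5F ∷ 6F ∷ 1F ∷ []
table k0 k2 k1 k1 k0 k0 = 3F ∷ 2F ∷ 0F ∷ 4F ∷ 5F ∷ 6F ∷ 1F ∷ []
table k0 k2 k1 k1 k0 k1 = 3F ∷ 2F ∷ 0F ∷ 4F ∷ 6F ∷ 5F ∷ 1F ∷ []
table k0 k2 k1 k1 k0 k2 = 3F ∷ 2F ∷ 0F ∷ 4F ∷ 5F ∷ 6F ∷ 1F ∷ []
table k0 k2 k1 k1 k1 k0 = 3F ∷ 2F ∷ 0F ∷ 4F ∷ 5F ∷ 6F ∷ 1F ∷ []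
table k0 k2 k1 k1 k1 k1 = 3F ∷ 2F ∷ 0F ∷ 4F ∷ 6F ∷ 5F ∷ 1F ∷ []
table k0 k2 k1 k1 k1 k2 = 3F ∷ 2F ∷ 0F ∷ 4F ∷ 6F ∷ 5F ∷ 1F ∷ []
table k0 k2 k1 k1 k2 k0 = 4F ∷ 2F ∷ 0F ∷ 3F ∷ 6F ∷ 5F ∷ 1F ∷ []
table k0 k2 k1 k1 k2 k1 = 4F ∷ 2F ∷ 0F ∷ 3F ∷ 5F ∷ 6F ∷ 1F ∷ []
table k0 k2 k1 k1 k2 k2 = 4F ∷ 2F ∷ 0F ∷ 3F ∷ 5F ∷ 6F ∷ 1F ∷ []
table k0 k2 k1 k2 k0 k0 = 4F ∷ 2F ∷ 0F ∷ 3F ∷ 6F ∷ 5F ∷ 1F ∷ []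
table k0 k2 k1 k2 k0 k1 = 4F ∷ 2F ∷ 0F ∷ 3F ∷ 6F ∷ 5F ∷ 1F ∷ []
table k0 k2 k1 k2 k0 k2 = 4F ∷ 2F ∷ 0F ∷ 3F ∷ 5F ∷ 6F ∷ 1F ∷ []
table k0 k2 k1 k2 k1 k0 = 3F ∷ 2F ∷ 0F ∷ 4F ∷ 6F ∷ 5F ∷ 1F ∷ []
table k0 k2 k1 k2 k1 k1 = 3F ∷ 2F ∷ 0F ∷ 4F ∷ 6F ∷ 5F ∷ 1F ∷ []
table k0 k2 k1 k2 k1 k2 = 3F ∷ 2F ∷ 0F ∷ 4F ∷ 5F ∷ 6F ∷ 1F ∷ []
table k0 k2 k1 k2 k2 k0 = 3F ∷ 2F ∷ 0F ∷ 4F ∷ 6F ∷ 5F ∷ 1F ∷ []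
table k0 k2 k1 k2 k2 k1 = 3F ∷ 2F ∷ 0F ∷ 4F ∷ 6F ∷ 5F ∷ 1F ∷ []
table k0 k2 k1 k2 k2 k2 = 3F ∷ 2F ∷ 0F ∷ 4F ∷ 5F ∷ 6F ∷ 1F ∷ []
table k0 k2 k2 k0 k0 k0 = 5F ∷ 1F ∷ 0F ∷ 4F ∷ 3F ∷ 6F ∷ 2F ∷ []
table k0 k2 k2 k0 k0 k1 = 5F ∷ 1F ∷ 0F ∷ 4F ∷ 3F ∷ 6F ∷ 2F ∷ []
table k0 k2 k2 k0 k0 k2 = 5F ∷ 1F ∷ 0F ∷ 4F ∷ 3F ∷ 6F ∷ 2F ∷ []
table k0 k2 k2 k0 k1 k0 = 6F ∷ 1F ∷ 0F ∷ 4F ∷ 3F ∷ 5F ∷ 2F ∷ []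
table k0 k2 k2 k0 k1 k1 = 5F ∷ 1F ∷ 0F ∷ 4F ∷ 3F ∷ 6F ∷ 2F ∷ []
table k0 k2 k2 k0 k1 k2 = 6F ∷ 1F ∷ 0F ∷ 4F ∷ 3F ∷ 5F ∷ 2F ∷ []
table k0 k2 k2 k0 k2 k0 = 5F ∷ 1F ∷ 0F ∷ 3F ∷ 4F ∷ 6F ∷ 2F ∷ []
table k0 k2 k2 k0 k2 k1 = 6F ∷ 1F ∷ 0F ∷ 3F ∷ 4F ∷ 5F ∷ 2F ∷ []
table k0 k2 k2 k0 k2 k2 = 5F ∷ 1F ∷ 0F ∷ 3F ∷ 4F ∷ 6F ∷ 2F ∷ []
table k0 k2 k2 k1 k0 k0 = 5F ∷ 1F ∷ 0F ∷ 4F ∷ 3F ∷ 6F ∷ 2F ∷ []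
table k0 k2 k2 k1 k0 k1 = 6F ∷ 1F ∷ 0F ∷ 4F ∷ 3F ∷ 5F ∷ 2F ∷ []
table k0 k2 k2 k1 k0 k2 = 6F ∷ 1F ∷ 0F ∷ 4F ∷ 3F ∷ 5F ∷ 2F ∷ []
table k0 k2 k2 k1 k1 k0 = 5F ∷ 1F ∷ 0F ∷ 3F ∷ 4F ∷ 6F ∷ 2F ∷ []
table k0 k2 k2 k1 k1 k1 = 6F ∷ 1F ∷ 0F ∷ 3F ∷ 4F ∷ 5F ∷ 2F ∷ []
table k0 k2 k2 k1 k1 k2 = 6F ∷ 1F ∷ 0F ∷ 3F ∷ 4F ∷ 5F ∷ 2F ∷ []
table k0 k2 k2 k1 k2 k0 = 5F ∷ 1F ∷ 0F ∷ 4F ∷ 3F ∷ 6F ∷ 2F ∷ []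
table k0 k2 k2 k1 k2 k1 = 5F ∷ 1F ∷ 0F ∷ 4F ∷ 3F ∷ 6F ∷ 2F ∷ []
table k0 k2 k2 k1 k2 k2 = 5F ∷ 1F ∷ 0F ∷ 4F ∷ 3F ∷ 6F ∷ 2F ∷ []
table k0 k2 k2 k2 k0 k0 = 5F ∷ 2F ∷ 0F ∷ 3F ∷ 4F ∷ 6F ∷ 1F ∷ []
table k0 k2 k2 k2 k0 k1 = 5F ∷ 2F ∷ 0F ∷ 3F ∷ 4F ∷ 6F ∷ 1F ∷ []
table k0 k2 k2 k2 k0 k2 = 6F ∷ 2F ∷ 0F ∷ 3F ∷ 4F ∷ 5F ∷ 1F ∷ []
table k0 k2 k2 k2 k1 k0 = 6F ∷ 2F ∷ 0F ∷ 3F ∷ 4F ∷ 5F ∷ 1F ∷ []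
table k0 k2 k2 k2 k1 k1 = 5F ∷ 2F ∷ 0F ∷ 3F ∷ 4F ∷ 6F ∷ 1F ∷ []
table k0 k2 k2 k2 k1 k2 = 5F ∷ 2F ∷ 0F ∷ 3F ∷ 4F ∷ 6F ∷ 1F ∷ []
table k0 k2 k2 k2 k2 k0 = 6F ∷ 2F ∷ 0F ∷ 3F ∷ 4F ∷ 5F ∷ 1F ∷ []
table k0 k2 k2 k2 k2 k1 = 6F ∷ 2F ∷ 0F ∷ 3F ∷ 4F ∷ 5F ∷ 1F ∷ []
table k0 k2 k2 k2 k2 k2 = 6F ∷ 2F ∷ 0F ∷ 3F ∷ 4F ∷ 5F ∷ 1F ∷ []
table k1 k0 k0 k0 k0 k0 = 2F ∷ 3F ∷ 6F ∷ 5F ∷ 0F ∷ 1F ∷ 4F ∷ []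
table k1 k0 k0 k0 k0 k1 = 2F ∷ 3F ∷ 5F ∷ 6F ∷ 0F ∷ 1F ∷ 4F ∷ []
table k1 k0 k0 k0 k0 k2 = 2F ∷ 3F ∷ 6F ∷ 5F ∷ 0F ∷ 1F ∷ 4F ∷ []
table k1 k0 k0 k0 k1 k0 = 2F ∷ 3F ∷ 6F ∷ 5F ∷ 0F ∷ 1F ∷ 4F ∷ []
table k1 k0 k0 k0 k1 k1 = 2F ∷ 3F ∷ 6F ∷ 5F ∷ 0F ∷ 1F ∷ 4F ∷ []
table k1 k0 k0 k0 k1 k2 = 2F ∷ 3F ∷ 6F ∷ 5F ∷ 0F ∷ 1F ∷ 4F ∷ []
table k1 k0 k0 k0 k2 k0 = 2F ∷ 4F ∷ 5F ∷ 6F ∷ 0F ∷ 1F ∷ 3F ∷ []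
table k1 k0 k0 k0 k2 k1 = 2F ∷ 4F ∷ 6F ∷ 5F ∷ 0F ∷ 1F ∷ 3F ∷ []
table k1 k0 k0 k0 k2 k2 = 2F ∷ 4F ∷ 5F ∷ 6F ∷ 0F ∷ 1F ∷ 3F ∷ []
table k1 k0 k0 k1 k0 k0 = 1F ∷ 4F ∷ 6F ∷ 5F ∷ 0F ∷ 2F ∷ 3F ∷ []
table k1 k0 k0 k1 k0 k1 = 1F ∷ 4F ∷ 6F ∷ 5F ∷ 0F ∷ 2F ∷ 3F ∷ []
table k1 k0 k0 k1 k0 k2 = 1F ∷ 4F ∷ 6F ∷ 5F ∷ 0F ∷ 2F ∷ 3F ∷ []
table k1 k0 k0 k1 k1 k0 = 1F ∷ 4F ∷ 5F ∷ 6F ∷ 0F ∷ 2F ∷ 3F ∷ []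
table k1 k0 k0 k1 k1 k1 = 1F ∷ 4F ∷ 5F ∷ 6F ∷ 0F ∷ 2F ∷ 3F ∷ []
table k1 k0 k0 k1 k1 k2 = 1F ∷ 4F ∷ 6F ∷ 5F ∷ 0F ∷ 2F ∷ 3F ∷ []
table k1 k0 k0 k1 k2 k0 = 1F ∷ 3F ∷ 5F ∷ 6F ∷ 0F ∷ 2F ∷ 4F ∷ []
table k1 k0 k0 k1 k2 k1 = 1F ∷ 3F ∷ 5F ∷ 6F ∷ 0F ∷ 2F ∷ 4F ∷ []
table k1 k0 k0 k1 k2 k2 = 1F ∷ 3F ∷ 5F ∷ 6F ∷ 0F ∷ 2F ∷ 4F ∷ []
table k1 k0 k0 k2 k0 k0 = 1F ∷ 4F ∷ 5F ∷ 6F ∷ 0F ∷ 2F ∷ 3F ∷ []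
table k1 k0 k0 k2 k0 k1 = 1F ∷ 4F ∷ 6F ∷ 5F ∷ 0F ∷ 2F ∷ 3F ∷ []
table k1 k0 k0 k2 k0 k2 = 1F ∷ 4F ∷ 5F ∷ 6F ∷ 0F ∷ 2F ∷ 3F ∷ []
table k1 k0 k0 k2 k1 k0 = 1F ∷ 4F ∷ 5F ∷ 6F ∷ 0F ∷ 2F ∷ 3F ∷ []
table k1 k0 k0 k2 k1 k1 = 1F ∷ 4F ∷ 5F ∷ 6F ∷ 0F ∷ 2F ∷ 3F ∷ []
table k1 k0 k0 k2 k1 k2 = 1F ∷ 4F ∷ 5F ∷ 6F ∷ 0F ∷ 2F ∷ 3F ∷ []
table k1 k0 k0 k2 k2 k0 = 1F ∷ 4F ∷ 6F ∷ 5F ∷ 0F ∷ 2F ∷ 3F ∷ []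
table k1 k0 k0 k2 k2 k1 = 1F ∷ 4F ∷ 5F ∷ 6F ∷ 0F ∷ 2F ∷ 3F ∷ []
table k1 k0 k0 k2 k2 k2 = 1F ∷ 4F ∷ 6F ∷ 5F ∷ 0F ∷ 2F ∷ 3F ∷ []
table k1 k0 k1 k0 k0 k0 = 2F ∷ 6F ∷ 3F ∷ 4F ∷ 0F ∷ 1F ∷ 5F ∷ []
table k1 k0 k1 k0 k0 k1 = 2F ∷ 6F ∷ 3F ∷ 4F ∷ 0F ∷ 1F ∷ 5F ∷ []
table k1 k0 k1 k0 k0 k2 = 2F ∷ 5F ∷ 3F ∷ 4F ∷ 0F ∷ 1F ∷ 6F ∷ []
table k1 k0 k1 k0 k1 k0 = 2F ∷ 6F ∷ 4F ∷ 3F ∷ 0F ∷ 1F ∷ 5F ∷ []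
table k1 k0 k1 k0 k1 k1 = 2F ∷ 5F ∷ 4F ∷ 3F ∷ 0F ∷ 1F ∷ 6F ∷ []
table k1 k0 k1 k0 k1 k2 = 2F ∷ 5F ∷ 4F ∷ 3F ∷ 0F ∷ 1F ∷ 6F ∷ []
table k1 k0 k1 k0 k2 k0 = 2F ∷ 5F ∷ 4F ∷ 3F ∷ 0F ∷ 1F ∷ 6F ∷ []
table k1 k0 k1 k0 k2 k1 = 2F ∷ 5F ∷ 4F ∷ 3F ∷ 0F ∷ 1F ∷ 6F ∷ []
table k1 k0 k1 k0 k2 k2 = 2F ∷ 6F ∷ 4F ∷ 3F ∷ 0F ∷ 1F ∷ 5F ∷ []
table k1 k0 k1 k1 k0 k0 = 1F ∷ 5F ∷ 4F ∷ 3F ∷ 0F ∷ 2F ∷ 6F ∷ []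
table k1 k0 k1 k1 k0 k1 = 1F ∷ 6F ∷ 4F ∷ 3F ∷ 0F ∷ 2F ∷ 5F ∷ []
table k1 k0 k1 k1 k0 k2 = 1F ∷ 6F ∷ 4F ∷ 3F ∷ 0F ∷ 2F ∷ 5F ∷ []
table k1 k0 k1 k1 k1 k0 = 1F ∷ 5F ∷ 3F ∷ 4F ∷ 0F ∷ 2F ∷ 6F ∷ []
table k1 k0 k1 k1 k1 k1 = 1F ∷ 5F ∷ 3F ∷ 4F ∷ 0F ∷ 2F ∷ 6F ∷ []
table k1 k0 k1 k1 k1 k2 = 1F ∷ 6F ∷ 3F ∷ 4F ∷ 0F ∷ 2F ∷ 5F ∷ []
table k1 k0 k1 k1 k2 k0 = 1F ∷ 5F ∷ 3F ∷ 4F ∷ 0F ∷ 2F ∷ 6F ∷ []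
table k1 k0 k1 k1 k2 k1 = 1F ∷ 6F ∷ 3F ∷ 4F ∷ 0F ∷ 2F ∷ 5F ∷ []
table k1 k0 k1 k1 k2 k2 = 1F ∷ 6F ∷ 3F ∷ 4F ∷ 0F ∷ 2F ∷ 5F ∷ []
table k1 k0 k1 k2 k0 k0 = 1F ∷ 5F ∷ 3F ∷ 4F ∷ 0F ∷ 2F ∷ 6F ∷ []
table k1 k0 k1 k2 k0 k1 = 1F ∷ 6F ∷ 3F ∷ 4F ∷ 0F ∷ 2F ∷ 5F ∷ []
table k1 k0 k1 k2 k0 k2 = 1F ∷ 5F ∷ 3F ∷ 4F ∷ 0F ∷ 2F ∷ 6F ∷ []
table k1 k0 k1 k2 k1 k0 = 1F ∷ 5F ∷ 4F ∷ 3F ∷ 0F ∷ 2F ∷ 6F ∷ []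
table k1 k0 k1 k2 k1 k1 = 1F ∷ 5F ∷ 4F ∷ 3F ∷ 0F ∷ 2F ∷ 6F ∷ []
table k1 k0 k1 k2 k1 k2 = 1F ∷ 6F ∷ 4F ∷ 3F ∷ 0F ∷ 2F ∷ 5F ∷ []
table k1 k0 k1 k2 k2 k0 = 1F ∷ 5F ∷ 4F ∷ 3F ∷ 0F ∷ 2F ∷ 6F ∷ []
table k1 k0 k1 k2 k2 k1 = 1F ∷ 5F ∷ 4F ∷ 3F ∷ 0F ∷ 2F ∷ 6F ∷ []
table k1 k0 k1 k2 k2 k2 = 1F ∷ 6F ∷ 4F ∷ 3F ∷ 0F ∷ 2F ∷ 5F ∷ []
table k1 k0 k2 k0 k0 k0 = 2F ∷ 6F ∷ 4F ∷ 5F ∷ 0F ∷ 1F ∷ 3F ∷ []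
table k1 k0 k2 k0 k0 k1 = 2F ∷ 6F ∷ 4F ∷ 5F ∷ 0F ∷ 1F ∷ 3F ∷ []
table k1 k0 k2 k0 k0 k2 = 2F ∷ 6F ∷ 4F ∷ 5F ∷ 0F ∷ 1F ∷ 3F ∷ []
table k1 k0 k2 k0 k1 k0 = 2F ∷ 5F ∷ 3F ∷ 6F ∷ 0F ∷ 1F ∷ 4F ∷ []
table k1 k0 k2 k0 k1 k1 = 2F ∷ 5F ∷ 3F ∷ 6F ∷ 0F ∷ 1F ∷ 4F ∷ []
table k1 k0 k2 k0 k1 k2 = 2F ∷ 5F ∷ 3F ∷ 6F ∷ 0F ∷ 1F ∷ 4F ∷ []
table k1 k0 k2 k0 k2 k0 = 2F ∷ 5F ∷ 4F ∷ 6F ∷ 0F ∷ 1F ∷ 3F ∷ []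
table k1 k0 k2 k0 k2 k1 = 2F ∷ 6F ∷ 4F ∷ 5F ∷ 0F ∷ 1F ∷ 3F ∷ []
table k1 k0 k2 k0 k2 k2 = 2F ∷ 5F ∷ 4F ∷ 6F ∷ 0F ∷ 1F ∷ 3F ∷ []
table k1 k0 k2 k1 k0 k0 = 2F ∷ 5F ∷ 4F ∷ 6F ∷ 0F ∷ 1F ∷ 3F ∷ []
table k1 k0 k2 k1 k0 k1 = 2F ∷ 5F ∷ 4F ∷ 6F ∷ 0F ∷ 1F ∷ 3F ∷ []
table k1 k0 k2 k1 k0 k2 = 2F ∷ 6F ∷ 4F ∷ 5F ∷ 0F ∷ 1F ∷ 3F ∷ []
table k1 k0 k2 k1 k1 k0 = 2F ∷ 5F ∷ 4F ∷ 6F ∷ 0F ∷ 1F ∷ 3F ∷ []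
table k1 k0 k2 k1 k1 k1 = 2F ∷ 5F ∷ 4F ∷ 6F ∷ 0F ∷ 1F ∷ 3F ∷ []
table k1 k0 k2 k1 k1 k2 = 2F ∷ 6F ∷ 4F ∷ 5F ∷ 0F ∷ 1F ∷ 3F ∷ []
table k1 k0 k2 k1 k2 k0 = 2F ∷ 5F ∷ 3F ∷ 6F ∷ 0F ∷ 1F ∷ 4F ∷ []
table k1 k0 k2 k1 k2 k1 = 2F ∷ 6F ∷ 3F ∷ 5F ∷ 0F ∷ 1F ∷ 4F ∷ []
table k1 k0 k2 k1 k2 k2 = 2F ∷ 6F ∷ 3F ∷ 5F ∷ 0F ∷ 1F ∷ 4F ∷ []
table k1 k0 k2 k2 k0 k0 = 1F ∷ 5F ∷ 3F ∷ 6F ∷ 0F ∷ 2F ∷ 4F ∷ []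
table k1 k0 k2 k2 k0 k1 = 1F ∷ 5F ∷ 3F ∷ 6F ∷ 0F ∷ 2F ∷ 4F ∷ []
table k1 k0 k2 k2 k0 k2 = 1F ∷ 5F ∷ 3F ∷ 6F ∷ 0F ∷ 2F ∷ 4F ∷ []
table k1 k0 k2 k2 k1 k0 = 1F ∷ 5F ∷ 4F ∷ 6F ∷ 0F ∷ 2F ∷ 3F ∷ []
table k1 k0 k2 k2 k1 k1 = 1F ∷ 5F ∷ 4F ∷ 6F ∷ 0F ∷ 2F ∷ 3F ∷ []
table k1 k0 k2 k2 k1 k2 = 1F ∷ 6F ∷ 4F ∷ 5F ∷ 0F ∷ 2F ∷ 3F ∷ []
table k1 k0 k2 k2 k2 k0 = 1F ∷ 6F ∷ 4F ∷ 5F ∷ 0F ∷ 2F ∷ 3F ∷ []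
table k1 k0 k2 k2 k2 k1 = 1F ∷ 6F ∷ 4F ∷ 5F ∷ 0F ∷ 2F ∷ 3F ∷ []
table k1 k0 k2 k2 k2 k2 = 1F ∷ 6F ∷ 4F ∷ 5F ∷ 0F ∷ 2F ∷ 3F ∷ []
table k1 k1 k0 k0 k0 k0 = 2F ∷ 5F ∷ 6F ∷ 4F ∷ 1F ∷ 0F ∷ 3F ∷ []
table k1 k1 k0 k0 k0 k1 = 2F ∷ 6F ∷ 5F ∷ 4F ∷ 1F ∷ 0F ∷ 3F ∷ []
table k1 k1 k0 k0 k0 k2 = 2F ∷ 5F ∷ 6F ∷ 4F ∷ 1F ∷ 0F ∷ 3F ∷ []
table k1 k1 k0 k0 k1 k0 = 2F ∷ 5F ∷ 6F ∷ 4F ∷ 1F ∷ 0F ∷ 3F ∷ []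
table k1 k1 k0 k0 k1 k1 = 2F ∷ 5F ∷ 6F ∷ 4F ∷ 1F ∷ 0F ∷ 3F ∷ []
table k1 k1 k0 k0 k1 k2 = 2F ∷ 6F ∷ 5F ∷ 4F ∷ 1F ∷ 0F ∷ 3F ∷ []
table k1 k1 k0 k0 k2 k0 = 2F ∷ 5F ∷ 6F ∷ 3F ∷ 1F ∷ 0F ∷ 4F ∷ []
table k1 k1 k0 k0 k2 k1 = 2F ∷ 5F ∷ 6F ∷ 3F ∷ 1F ∷ 0F ∷ 4F ∷ []
table k1 k1 k0 k0 k2 k2 = 2F ∷ 5F ∷ 6F ∷ 3F ∷ 1F ∷ 0F ∷ 4F ∷ []
table k1 k1 k0 k1 k0 k0 = 1F ∷ 5F ∷ 6F ∷ 3F ∷ 2F ∷ 0F ∷ 4F ∷ []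
table k1 k1 k0 k1 k0 k1 = 1F ∷ 5F ∷ 6F ∷ 3F ∷ 2F ∷ 0F ∷ 4F ∷ []
table k1 k1 k0 k1 k0 k2 = 1F ∷ 6F ∷ 5F ∷ 3F ∷ 2F ∷ 0F ∷ 4F ∷ []
table k1 k1 k0 k1 k1 k0 = 1F ∷ 6F ∷ 5F ∷ 3F ∷ 2F ∷ 0F ∷ 4F ∷ []
table k1 k1 k0 k1 k1 k1 = 1F ∷ 6F ∷ 5F ∷ 3F ∷ 2F ∷ 0F ∷ 4F ∷ []
table k1 k1 k0 k1 k1 k2 = 1F ∷ 6F ∷ 5F ∷ 3F ∷ 2F ∷ 0F ∷ 4F ∷ []
table k1 k1 k0 k1 k2 k0 = 1F ∷ 6F ∷ 5F ∷ 4F ∷ 2F ∷ 0F ∷ 3F ∷ []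
table k1 k1 k0 k1 k2 k1 = 1F ∷ 6F ∷ 5F ∷ 4F ∷ 2F ∷ 0F ∷ 3F ∷ []
table k1 k1 k0 k1 k2 k2 = 1F ∷ 5F ∷ 6F ∷ 4F ∷ 2F ∷ 0F ∷ 3F ∷ []
table k1 k1 k0 k2 k0 k0 = 1F ∷ 5F ∷ 6F ∷ 3F ∷ 2F ∷ 0F ∷ 4F ∷ []
table k1 k1 k0 k2 k0 k1 = 1F ∷ 6F ∷ 5F ∷ 3F ∷ 2F ∷ 0F ∷ 4F ∷ []
table k1 k1 k0 k2 k0 k2 = 1F ∷ 6F ∷ 5F ∷ 3F ∷ 2F ∷ 0F ∷ 4F ∷ []
table k1 k1 k0 k2 k1 k0 = 1F ∷ 6F ∷ 5F ∷ 3F ∷ 2F ∷ 0F ∷ 4F ∷ []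
table k1 k1 k0 k2 k1 k1 = 1F ∷ 5F ∷ 6F ∷ 3F ∷ 2F ∷ 0F ∷ 4F ∷ []
table k1 k1 k0 k2 k1 k2 = 1F ∷ 5F ∷ 6F ∷ 3F ∷ 2F ∷ 0F ∷ 4F ∷ []
table k1 k1 k0 k2 k2 k0 = 1F ∷ 6F ∷ 5F ∷ 4F ∷ 2F ∷ 0F ∷ 3F ∷ []
table k1 k1 k0 k2 k2 k1 = 1F ∷ 6F ∷ 5F ∷ 4F ∷ 2F ∷ 0F ∷ 3F ∷ []
table k1 k1 k0 k2 k2 k2 = 1F ∷ 6F ∷ 5F ∷ 4F ∷ 2F ∷ 0F ∷ 3F ∷ []
table k1 k1 k1 k0 k0 k0 = 1F ∷ 5F ∷ 6F ∷ 4F ∷ 2F ∷ 0F ∷ 3F ∷ []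
table k1 k1 k1 k0 k0 k1 = 1F ∷ 5F ∷ 6F ∷ 4F ∷ 2F ∷ 0F ∷ 3F ∷ []
table k1 k1 k1 k0 k0 k2 = 1F ∷ 6F ∷ 5F ∷ 4F ∷ 2F ∷ 0F ∷ 3F ∷ []
table k1 k1 k1 k0 k1 k0 = 1F ∷ 6F ∷ 5F ∷ 3F ∷ 2F ∷ 0F ∷ 4F ∷ []
table k1 k1 k1 k0 k1 k1 = 1F ∷ 6F ∷ 5F ∷ 3F ∷ 2F ∷ 0F ∷ 4F ∷ []
table k1 k1 k1 k0 k1 k2 = 1F ∷ 5F ∷ 6F ∷ 3F ∷ 2F ∷ 0F ∷ 4F ∷ []
table k1 k1 k1 k0 k2 k0 = 1F ∷ 6F ∷ 5F ∷ 3F ∷ 2F ∷ 0F ∷ 4F ∷ []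
table k1 k1 k1 k0 k2 k1 = 1F ∷ 6F ∷ 5F ∷ 3F ∷ 2F ∷ 0F ∷ 4F ∷ []
table k1 k1 k1 k0 k2 k2 = 1F ∷ 6F ∷ 5F ∷ 3F ∷ 2F ∷ 0F ∷ 4F ∷ []
table k1 k1 k1 k1 k0 k0 = 2F ∷ 5F ∷ 6F ∷ 3F ∷ 1F ∷ 0F ∷ 4F ∷ []
table k1 k1 k1 k1 k0 k1 = 2F ∷ 6F ∷ 5F ∷ 3F ∷ 1F ∷ 0F ∷ 4F ∷ []
table k1 k1 k1 k1 k0 k2 = 2F ∷ 5F ∷ 6F ∷ 3F ∷ 1F ∷ 0F ∷ 4F ∷ []
table k1 k1 k1 k1 k1 k0 = 2F ∷ 6F ∷ 5F ∷ 4F ∷ 1F ∷ 0F ∷ 3F ∷ []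
table k1 k1 k1 k1 k1 k1 = 2F ∷ 5F ∷ 6F ∷ 4F ∷ 1F ∷ 0F ∷ 3F ∷ []
table k1 k1 k1 k1 k1 k2 = 2F ∷ 5F ∷ 6F ∷ 4F ∷ 1F ∷ 0F ∷ 3F ∷ []
table k1 k1 k1 k1 k2 k0 = 2F ∷ 6F ∷ 5F ∷ 3F ∷ 1F ∷ 0F ∷ 4F ∷ []
table k1 k1 k1 k1 k2 k1 = 2F ∷ 5F ∷ 6F ∷ 3F ∷ 1F ∷ 0F ∷ 4F ∷ []
table k1 k1 k1 k1 k2 k2 = 2F ∷ 6F ∷ 5F ∷ 3F ∷ 1F ∷ 0F ∷ 4F ∷ []
table k1 k1 k1 k2 k0 k0 = 1F ∷ 5F ∷ 6F ∷ 4F ∷ 2F ∷ 0F ∷ 3F ∷ []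
table k1 k1 k1 k2 k0 k1 = 1F ∷ 5F ∷ 6F ∷ 4F ∷ 2F ∷ 0F ∷ 3F ∷ []
table k1 k1 k1 k2 k0 k2 = 1F ∷ 5F ∷ 6F ∷ 4F ∷ 2F ∷ 0F ∷ 3F ∷ []
table k1 k1 k1 k2 k1 k0 = 1F ∷ 5F ∷ 6F ∷ 4F ∷ 2F ∷ 0F ∷ 3F ∷ []
table k1 k1 k1 k2 k1 k1 = 1F ∷ 5F ∷ 6F ∷ 4F ∷ 2F ∷ 0F ∷ 3F ∷ []
table k1 k1 k1 k2 k1 k2 = 1F ∷ 6F ∷ 5F ∷ 4F ∷ 2F ∷ 0F ∷ 3F ∷ []
table k1 k1 k1 k2 k2 k0 = 1F ∷ 6F ∷ 5F ∷ 4F ∷ 2F ∷ 0F ∷ 3F ∷ []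
table k1 k1 k1 k2 k2 k1 = 1F ∷ 6F ∷ 5F ∷ 4F ∷ 2F ∷ 0F ∷ 3F ∷ []
table k1 k1 k1 k2 k2 k2 = 1F ∷ 6F ∷ 5F ∷ 4F ∷ 2F ∷ 0F ∷ 3F ∷ []
table k1 k1 k2 k0 k0 k0 = 1F ∷ 4F ∷ 3F ∷ 5F ∷ 2F ∷ 0F ∷ 6F ∷ []
table k1 k1 k2 k0 k0 k1 = 1F ∷ 4F ∷ 3F ∷ 5F ∷ 2F ∷ 0F ∷ 6F ∷ []
table k1 k1 k2 k0 k0 k2 = 1F ∷ 4F ∷ 3F ∷ 6F ∷ 2F ∷ 0F ∷ 5F ∷ []
table k1 k1 k2 k0 k1 k0 = 1F ∷ 3F ∷ 4F ∷ 5F ∷ 2F ∷ 0F ∷ 6F ∷ []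
table k1 k1 k2 k0 k1 k1 = 1F ∷ 3F ∷ 4F ∷ 5F ∷ 2F ∷ 0F ∷ 6F ∷ []
table k1 k1 k2 k0 k1 k2 = 1F ∷ 3F ∷ 4F ∷ 5F ∷ 2F ∷ 0F ∷ 6F ∷ []
table k1 k1 k2 k0 k2 k0 = 1F ∷ 3F ∷ 4F ∷ 6F ∷ 2F ∷ 0F ∷ 5F ∷ []
table k1 k1 k2 k0 k2 k1 = 1F ∷ 3F ∷ 4F ∷ 5F ∷ 2F ∷ 0F ∷ 6F ∷ []
table k1 k1 k2 k0 k2 k2 = 1F ∷ 3F ∷ 4F ∷ 5F ∷ 2F ∷ 0F ∷ 6F ∷ []
table k1 k1 k2 k1 k0 k0 = 1F ∷ 4F ∷ 3F ∷ 6F ∷ 2F ∷ 0F ∷ 5F ∷ []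
table k1 k1 k2 k1 k0 k1 = 1F ∷ 4F ∷ 3F ∷ 5F ∷ 2F ∷ 0F ∷ 6F ∷ []
table k1 k1 k2 k1 k0 k2 = 1F ∷ 4F ∷ 3F ∷ 6F ∷ 2F ∷ 0F ∷ 5F ∷ []
table k1 k1 k2 k1 k1 k0 = 1F ∷ 4F ∷ 3F ∷ 6F ∷ 2F ∷ 0F ∷ 5F ∷ []
table k1 k1 k2 k1 k1 k1 = 1F ∷ 4F ∷ 3F ∷ 6F ∷ 2F ∷ 0F ∷ 5F ∷ []
table k1 k1 k2 k1 k1 k2 = 1F ∷ 4F ∷ 3F ∷ 5F ∷ 2F ∷ 0F ∷ 6F ∷ []
table k1 k1 k2 k1 k2 k0 = 1F ∷ 4F ∷ 3F ∷ 5F ∷ 2F ∷ 0F ∷ 6F ∷ []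
table k1 k1 k2 k1 k2 k1 = 1F ∷ 4F ∷ 3F ∷ 6F ∷ 2F ∷ 0F ∷ 5F ∷ []
table k1 k1 k2 k1 k2 k2 = 1F ∷ 4F ∷ 3F ∷ 5F ∷ 2F ∷ 0F ∷ 6F ∷ []
table k1 k1 k2 k2 k0 k0 = 1F ∷ 4F ∷ 3F ∷ 6F ∷ 2F ∷ 0F ∷ 5F ∷ []
table k1 k1 k2 k2 k0 k1 = 1F ∷ 4F ∷ 3F ∷ 5F ∷ 2F ∷ 0F ∷ 6F ∷ []
table k1 k1 k2 k2 k0 k2 = 1F ∷ 4F ∷ 3F ∷ 6F ∷ 2F ∷ 0F ∷ 5F ∷ []
table k1 k1 k2 k2 k1 k0 = 1F ∷ 4F ∷ 3F ∷ 5F ∷ 2F ∷ 0F ∷ 6F ∷ []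
table k1 k1 k2 k2 k1 k1 = 1F ∷ 4F ∷ 3F ∷ 5F ∷ 2F ∷ 0F ∷ 6F ∷ []
table k1 k1 k2 k2 k1 k2 = 1F ∷ 4F ∷ 3F ∷ 6F ∷ 2F ∷ 0F ∷ 5F ∷ []
table k1 k1 k2 k2 k2 k0 = 1F ∷ 4F ∷ 3F ∷ 5F ∷ 2F ∷ 0F ∷ 6F ∷ []
table k1 k1 k2 k2 k2 k1 = 1F ∷ 4F ∷ 3F ∷ 6F ∷ 2F ∷ 0F ∷ 5F ∷ []
table k1 k1 k2 k2 k2 k2 = 1F ∷ 4F ∷ 3F ∷ 6F ∷ 2F ∷ 0F ∷ 5F ∷ []
table k1 k2 k0 k0 k0 k0 = 1F ∷ 3F ∷ 6F ∷ 5F ∷ 2F ∷ 0F ∷ 4F ∷ []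
table k1 k2 k0 k0 k0 k1 = 1F ∷ 3F ∷ 6F ∷ 5F ∷ 2F ∷ 0F ∷ 4F ∷ []
table k1 k2 k0 k0 k0 k2 = 1F ∷ 3F ∷ 6F ∷ 5F ∷ 2F ∷ 0F ∷ 4F ∷ []
table k1 k2 k0 k0 k1 k0 = 1F ∷ 3F ∷ 5F ∷ 6F ∷ 2F ∷ 0F ∷ 4F ∷ []
table k1 k2 k0 k0 k1 k1 = 1F ∷ 3F ∷ 6F ∷ 5F ∷ 2F ∷ 0F ∷ 4F ∷ []
table k1 k2 k0 k0 k1 k2 = 1F ∷ 3F ∷ 6F ∷ 5F ∷ 2F ∷ 0F ∷ 4F ∷ []
table k1 k2 k0 k0 k2 k0 = 1F ∷ 3F ∷ 5F ∷ 6F ∷ 2F ∷ 0F ∷ 4F ∷ []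
table k1 k2 k0 k0 k2 k1 = 1F ∷ 3F ∷ 5F ∷ 6F ∷ 2F ∷ 0F ∷ 4F ∷ []
table k1 k2 k0 k0 k2 k2 = 1F ∷ 3F ∷ 6F ∷ 5F ∷ 2F ∷ 0F ∷ 4F ∷ []
table k1 k2 k0 k1 k0 k0 = 1F ∷ 4F ∷ 6F ∷ 5F ∷ 2F ∷ 0F ∷ 3F ∷ []
table k1 k2 k0 k1 k0 k1 = 1F ∷ 4F ∷ 5F ∷ 6F ∷ 2F ∷ 0F ∷ 3F ∷ []
table k1 k2 k0 k1 k0 k2 = 1F ∷ 4F ∷ 5F ∷ 6F ∷ 2F ∷ 0F ∷ 3F ∷ []
table k1 k2 k0 k1 k1 k0 = 1F ∷ 4F ∷ 5F ∷ 6F ∷ 2F ∷ 0F ∷ 3F ∷ []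
table k1 k2 k0 k1 k1 k1 = 1F ∷ 4F ∷ 6F ∷ 5F ∷ 2F ∷ 0F ∷ 3F ∷ []
table k1 k2 k0 k1 k1 k2 = 1F ∷ 4F ∷ 6F ∷ 5F ∷ 2F ∷ 0F ∷ 3F ∷ []
table k1 k2 k0 k1 k2 k0 = 1F ∷ 3F ∷ 5F ∷ 6F ∷ 2F ∷ 0F ∷ 4F ∷ []
table k1 k2 k0 k1 k2 k1 = 1F ∷ 3F ∷ 5F ∷ 6F ∷ 2F ∷ 0F ∷ 4F ∷ []
table k1 k2 k0 k1 k2 k2 = 1F ∷ 3F ∷ 6F ∷ 5F ∷ 2F ∷ 0F ∷ 4F ∷ []
table k1 k2 k0 k2 k0 k0 = 1F ∷ 4F ∷ 6F ∷ 5F ∷ 2F ∷ 0F ∷ 3F ∷ []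
table k1 k2 k0 k2 k0 k1 = 1F ∷ 4F ∷ 6F ∷ 5F ∷ 2F ∷ 0F ∷ 3F ∷ []
table k1 k2 k0 k2 k0 k2 = 1F ∷ 4F ∷ 6F ∷ 5F ∷ 2F ∷ 0F ∷ 3F ∷ []
table k1 k2 k0 k2 k1 k0 = 1F ∷ 3F ∷ 5F ∷ 6F ∷ 2F ∷ 0F ∷ 4F ∷ []
table k1 k2 k0 k2 k1 k1 = 1F ∷ 3F ∷ 6F ∷ 5F ∷ 2F ∷ 0F ∷ 4F ∷ []
table k1 k2 k0 k2 k1 k2 = 1F ∷ 3F ∷ 6F ∷ 5F ∷ 2F ∷ 0F ∷ 4F ∷ []
table k1 k2 k0 k2 k2 k0 = 1F ∷ 4F ∷ 5F ∷ 6F ∷ 2F ∷ 0F ∷ 3F ∷ []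
table k1 k2 k0 k2 k2 k1 = 1F ∷ 4F ∷ 5F ∷ 6F ∷ 2F ∷ 0F ∷ 3F ∷ []
table k1 k2 k0 k2 k2 k2 = 1F ∷ 4F ∷ 6F ∷ 5F ∷ 2F ∷ 0F ∷ 3F ∷ []
table k1 k2 k1 k0 k0 k0 = 2F ∷ 3F ∷ 6F ∷ 4F ∷ 1F ∷ 0F ∷ 5F ∷ []
table k1 k2 k1 k0 k0 k1 = 2F ∷ 3F ∷ 6F ∷ 4F ∷ 1F ∷ 0F ∷ 5F ∷ []
table k1 k2 k1 k0 k0 k2 = 2F ∷ 3F ∷ 5F ∷ 4F ∷ 1F ∷ 0F ∷ 6F ∷ []
table k1 k2 k1 k0 k1 k0 = 2F ∷ 3F ∷ 5F ∷ 4F ∷ 1F ∷ 0F ∷ 6F ∷ []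
table k1 k2 k1 k0 k1 k1 = 2F ∷ 3F ∷ 6F ∷ 4F ∷ 1F ∷ 0F ∷ 5F ∷ []
table k1 k2 k1 k0 k1 k2 = 2F ∷ 3F ∷ 5F ∷ 4F ∷ 1F ∷ 0F ∷ 6F ∷ []
table k1 k2 k1 k0 k2 k0 = 2F ∷ 3F ∷ 5F ∷ 4F ∷ 1F ∷ 0F ∷ 6F ∷ []
table k1 k2 k1 k0 k2 k1 = 2F ∷ 3F ∷ 6F ∷ 4F ∷ 1F ∷ 0F ∷ 5F ∷ []
table k1 k2 k1 k0 k2 k2 = 2F ∷ 3F ∷ 5F ∷ 4F ∷ 1F ∷ 0F ∷ 6F ∷ []
table k1 k2 k1 k1 k0 k0 = 1F ∷ 4F ∷ 6F ∷ 3F ∷ 2F ∷ 0F ∷ 5F ∷ []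
table k1 k2 k1 k1 k0 k1 = 1F ∷ 4F ∷ 5F ∷ 3F ∷ 2F ∷ 0F ∷ 6F ∷ []
table k1 k2 k1 k1 k0 k2 = 1F ∷ 4F ∷ 6F ∷ 3F ∷ 2F ∷ 0F ∷ 5F ∷ []
table k1 k2 k1 k1 k1 k0 = 1F ∷ 3F ∷ 5F ∷ 4F ∷ 2F ∷ 0F ∷ 6F ∷ []
table k1 k2 k1 k1 k1 k1 = 1F ∷ 3F ∷ 6F ∷ 4F ∷ 2F ∷ 0F ∷ 5F ∷ []
table k1 k2 k1 k1 k1 k2 = 1F ∷ 3F ∷ 5F ∷ 4F ∷ 2F ∷ 0F ∷ 6F ∷ []
table k1 k2 k1 k1 k2 k0 = 1F ∷ 4F ∷ 6F ∷ 3F ∷ 2F ∷ 0F ∷ 5F ∷ []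
table k1 k2 k1 k1 k2 k1 = 1F ∷ 4F ∷ 6F ∷ 3F ∷ 2F ∷ 0F ∷ 5F ∷ []
table k1 k2 k1 k1 k2 k2 = 1F ∷ 4F ∷ 5F ∷ 3F ∷ 2F ∷ 0F ∷ 6F ∷ []
table k1 k2 k1 k2 k0 k0 = 1F ∷ 4F ∷ 6F ∷ 3F ∷ 2F ∷ 0F ∷ 5F ∷ []
table k1 k2 k1 k2 k0 k1 = 1F ∷ 4F ∷ 5F ∷ 3F ∷ 2F ∷ 0F ∷ 6F ∷ []
table k1 k2 k1 k2 k0 k2 = 1F ∷ 4F ∷ 5F ∷ 3F ∷ 2F ∷ 0F ∷ 6F ∷ []
table k1 k2 k1 k2 k1 k0 = 1F ∷ 4F ∷ 5F ∷ 3F ∷ 2F ∷ 0F ∷ 6F ∷ []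
table k1 k2 k1 k2 k1 k1 = 1F ∷ 4F ∷ 6F ∷ 3F ∷ 2F ∷ 0F ∷ 5F ∷ []
table k1 k2 k1 k2 k1 k2 = 1F ∷ 4F ∷ 5F ∷ 3F ∷ 2F ∷ 0F ∷ 6F ∷ []
table k1 k2 k1 k2 k2 k0 = 1F ∷ 3F ∷ 6F ∷ 4F ∷ 2F ∷ 0F ∷ 5F ∷ []
table k1 k2 k1 k2 k2 k1 = 1F ∷ 3F ∷ 6F ∷ 4F ∷ 2F ∷ 0F ∷ 5F ∷ []
table k1 k2 k1 k2 k2 k2 = 1F ∷ 3F ∷ 5F ∷ 4F ∷ 2F ∷ 0F ∷ 6F ∷ []
table k1 k2 k2 k0 k0 k0 = 1F ∷ 4F ∷ 5F ∷ 3F ∷ 2F ∷ 0F ∷ 6F ∷ []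
table k1 k2 k2 k0 k0 k1 = 1F ∷ 4F ∷ 6F ∷ 3F ∷ 2F ∷ 0F ∷ 5F ∷ []
table k1 k2 k2 k0 k0 k2 = 1F ∷ 4F ∷ 5F ∷ 3F ∷ 2F ∷ 0F ∷ 6F ∷ []
table k1 k2 k2 k0 k1 k0 = 1F ∷ 3F ∷ 5F ∷ 4F ∷ 2F ∷ 0F ∷ 6F ∷ []
table k1 k2 k2 k0 k1 k1 = 1F ∷ 3F ∷ 5F ∷ 4F ∷ 2F ∷ 0F ∷ 6F ∷ []
table k1 k2 k2 k0 k1 k2 = 1F ∷ 3F ∷ 5F ∷ 4F ∷ 2F ∷ 0F ∷ 6F ∷ []
table k1 k2 k2 k0 k2 k0 = 1F ∷ 4F ∷ 5F ∷ 3F ∷ 2F ∷ 0F ∷ 6F ∷ []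
table k1 k2 k2 k0 k2 k1 = 1F ∷ 4F ∷ 5F ∷ 3F ∷ 2F ∷ 0F ∷ 6F ∷ []
table k1 k2 k2 k0 k2 k2 = 1F ∷ 4F ∷ 6F ∷ 3F ∷ 2F ∷ 0F ∷ 5F ∷ []
table k1 k2 k2 k1 k0 k0 = 2F ∷ 3F ∷ 6F ∷ 4F ∷ 1F ∷ 0F ∷ 5F ∷ []
table k1 k2 k2 k1 k0 k1 = 2F ∷ 3F ∷ 5F ∷ 4F ∷ 1F ∷ 0F ∷ 6F ∷ []
table k1 k2 k2 k1 k0 k2 = 2F ∷ 3F ∷ 5F ∷ 4F ∷ 1F ∷ 0F ∷ 6F ∷ []
table k1 k2 k2 k1 k1 k0 = 2F ∷ 4F ∷ 5F ∷ 3F ∷ 1F ∷ 0F ∷ 6F ∷ []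
table k1 k2 k2 k1 k1 k1 = 2F ∷ 4F ∷ 6F ∷ 3F ∷ 1F ∷ 0F ∷ 5F ∷ []
table k1 k2 k2 k1 k1 k2 = 2F ∷ 4F ∷ 5F ∷ 3F ∷ 1F ∷ 0F ∷ 6F ∷ []
table k1 k2 k2 k1 k2 k0 = 2F ∷ 3F ∷ 6F ∷ 4F ∷ 1F ∷ 0F ∷ 5F ∷ []
table k1 k2 k2 k1 k2 k1 = 2F ∷ 3F ∷ 5F ∷ 4F ∷ 1F ∷ 0F ∷ 6F ∷ []
table k1 k2 k2 k1 k2 k2 = 2F ∷ 3F ∷ 5F ∷ 4F ∷ 1F ∷ 0F ∷ 6F ∷ []
table k1 k2 k2 k2 k0 k0 = 1F ∷ 4F ∷ 6F ∷ 3F ∷ 2F ∷ 0F ∷ 5F ∷ []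
table k1 k2 k2 k2 k0 k1 = 1F ∷ 4F ∷ 5F ∷ 3F ∷ 2F ∷ 0F ∷ 6F ∷ []
table k1 k2 k2 k2 k0 k2 = 1F ∷ 4F ∷ 6F ∷ 3F ∷ 2F ∷ 0F ∷ 5F ∷ []
table k1 k2 k2 k2 k1 k0 = 1F ∷ 4F ∷ 6F ∷ 3F ∷ 2F ∷ 0F ∷ 5F ∷ []
table k1 k2 k2 k2 k1 k1 = 1F ∷ 4F ∷ 5F ∷ 3F ∷ 2F ∷ 0F ∷ 6F ∷ []
table k1 k2 k2 k2 k1 k2 = 1F ∷ 4F ∷ 5F ∷ 3F ∷ 2F ∷ 0F ∷ 6F ∷ []
table k1 k2 k2 k2 k2 k0 = 1F ∷ 3F ∷ 5F ∷ 4F ∷ 2F ∷ 0F ∷ 6F ∷ []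
table k1 k2 k2 k2 k2 k1 = 1F ∷ 3F ∷ 6F ∷ 4F ∷ 2F ∷ 0F ∷ 5F ∷ []
table k1 k2 k2 k2 k2 k2 = 1F ∷ 3F ∷ 6F ∷ 4F ∷ 2F ∷ 0F ∷ 5F ∷ []
table k2 k0 k0 k0 k0 k0 = 1F ∷ 2F ∷ 5F ∷ 0F ∷ 4F ∷ 6F ∷ 3F ∷ []
table k2 k0 k0 k0 k0 k1 = 1F ∷ 2F ∷ 6F ∷ 0F ∷ 4F ∷ 5F ∷ 3F ∷ []
table k2 k0 k0 k0 k0 k2 = 1F ∷ 2F ∷ 6F ∷ 0F ∷ 4F ∷ 5F ∷ 3F ∷ []
table k2 k0 k0 k0 k1 k0 = 1F ∷ 2F ∷ 5F ∷ 0F ∷ 3F ∷ 6F ∷ 4F ∷ []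
table k2 k0 k0 k0 k1 k1 = 1F ∷ 2F ∷ 6F ∷ 0F ∷ 3F ∷ 5F ∷ 4F ∷ []
table k2 k0 k0 k0 k1 k2 = 1F ∷ 2F ∷ 6F ∷ 0F ∷ 3F ∷ 5F ∷ 4F ∷ []
table k2 k0 k0 k0 k2 k0 = 1F ∷ 2F ∷ 5F ∷ 0F ∷ 3F ∷ 6F ∷ 4F ∷ []
table k2 k0 k0 k0 k2 k1 = 1F ∷ 2F ∷ 5F ∷ 0F ∷ 3F ∷ 6F ∷ 4F ∷ []
table k2 k0 k0 k0 k2 k2 = 1F ∷ 2F ∷ 6F ∷ 0F ∷ 3F ∷ 5F ∷ 4F ∷ []
table k2 k0 k0 k1 k0 k0 = 2F ∷ 1F ∷ 5F ∷ 0F ∷ 3F ∷ 6F ∷ 4F ∷ []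
table k2 k0 k0 k1 k0 k1 = 2F ∷ 1F ∷ 6F ∷ 0F ∷ 3F ∷ 5F ∷ 4F ∷ []
table k2 k0 k0 k1 k0 k2 = 2F ∷ 1F ∷ 5F ∷ 0F ∷ 3F ∷ 6F ∷ 4F ∷ []
table k2 k0 k0 k1 k1 k0 = 2F ∷ 1F ∷ 5F ∷ 0F ∷ 4F ∷ 6F ∷ 3F ∷ []
table k2 k0 k0 k1 k1 k1 = 2F ∷ 1F ∷ 6F ∷ 0F ∷ 4F ∷ 5F ∷ 3F ∷ []
table k2 k0 k0 k1 k1 k2 = 2F ∷ 1F ∷ 5F ∷ 0F ∷ 4F ∷ 6F ∷ 3F ∷ []
table k2 k0 k0 k1 k2 k0 = 2F ∷ 1F ∷ 5F ∷ 0F ∷ 3F ∷ 6F ∷ 4F ∷ []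
table k2 k0 k0 k1 k2 k1 = 2F ∷ 1F ∷ 5F ∷ 0F ∷ 3F ∷ 6F ∷ 4F ∷ []
table k2 k0 k0 k1 k2 k2 = 2F ∷ 1F ∷ 5F ∷ 0F ∷ 3F ∷ 6F ∷ 4F ∷ []
table k2 k0 k0 k2 k0 k0 = 1F ∷ 2F ∷ 5F ∷ 0F ∷ 4F ∷ 6F ∷ 3F ∷ []
table k2 k0 k0 k2 k0 k1 = 1F ∷ 2F ∷ 5F ∷ 0F ∷ 4F ∷ 6F ∷ 3F ∷ []
table k2 k0 k0 k2 k0 k2 = 1F ∷ 2F ∷ 6F ∷ 0F ∷ 4F ∷ 5F ∷ 3F ∷ []
table k2 k0 k0 k2 k1 k0 = 1F ∷ 2F ∷ 6F ∷ 0F ∷ 3F ∷ 5F ∷ 4F ∷ []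
table k2 k0 k0 k2 k1 k1 = 1F ∷ 2F ∷ 5F ∷ 0F ∷ 3F ∷ 6F ∷ 4F ∷ []
table k2 k0 k0 k2 k1 k2 = 1F ∷ 2F ∷ 6F ∷ 0F ∷ 3F ∷ 5F ∷ 4F ∷ []
table k2 k0 k0 k2 k2 k0 = 1F ∷ 2F ∷ 6F ∷ 0F ∷ 4F ∷ 5F ∷ 3F ∷ []
table k2 k0 k0 k2 k2 k1 = 1F ∷ 2F ∷ 5F ∷ 0F ∷ 4F ∷ 6F ∷ 3F ∷ []
table k2 k0 k0 k2 k2 k2 = 1F ∷ 2F ∷ 5F ∷ 0F ∷ 4F ∷ 6F ∷ 3F ∷ []
table k2 k0 k1 k0 k0 k0 = 2F ∷ 1F ∷ 4F ∷ 0F ∷ 5F ∷ 3F ∷ 6F ∷ []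
table k2 k0 k1 k0 k0 k1 = 2F ∷ 1F ∷ 4F ∷ 0F ∷ 5F ∷ 3F ∷ 6F ∷ []
table k2 k0 k1 k0 k0 k2 = 2F ∷ 1F ∷ 4F ∷ 0F ∷ 6F ∷ 3F ∷ 5F ∷ []
table k2 k0 k1 k0 k1 k0 = 2F ∷ 1F ∷ 4F ∷ 0F ∷ 6F ∷ 3F ∷ 5F ∷ []
table k2 k0 k1 k0 k1 k1 = 2F ∷ 1F ∷ 4F ∷ 0F ∷ 5F ∷ 3F ∷ 6F ∷ []
table k2 k0 k1 k0 k1 k2 = 2F ∷ 1F ∷ 4F ∷ 0F ∷ 5F ∷ 3F ∷ 6F ∷ []
table k2 k0 k1 k0 k2 k0 = 2F ∷ 1F ∷ 4F ∷ 0F ∷ 5F ∷ 3F ∷ 6F ∷ []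
table k2 k0 k1 k0 k2 k1 = 2F ∷ 1F ∷ 4F ∷ 0F ∷ 5F ∷ 3F ∷ 6F ∷ []
table k2 k0 k1 k0 k2 k2 = 2F ∷ 1F ∷ 4F ∷ 0F ∷ 5F ∷ 3F ∷ 6F ∷ []
table k2 k0 k1 k1 k0 k0 = 1F ∷ 2F ∷ 3F ∷ 0F ∷ 6F ∷ 4F ∷ 5F ∷ []
table k2 k0 k1 k1 k0 k1 = 1F ∷ 2F ∷ 3F ∷ 0F ∷ 6F ∷ 4F ∷ 5F ∷ []
table k2 k0 k1 k1 k0 k2 = 1F ∷ 2F ∷ 3F ∷ 0F ∷ 6F ∷ 4F ∷ 5F ∷ []
table k2 k0 k1 k1 k1 k0 = 1F ∷ 2F ∷ 3F ∷ 0F ∷ 6F ∷ 4F ∷ 5F ∷ []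
table k2 k0 k1 k1 k1 k1 = 1F ∷ 2F ∷ 3F ∷ 0F ∷ 5F ∷ 4F ∷ 6F ∷ []
table k2 k0 k1 k1 k1 k2 = 1F ∷ 2F ∷ 3F ∷ 0F ∷ 6F ∷ 4F ∷ 5F ∷ []
table k2 k0 k1 k1 k2 k0 = 1F ∷ 2F ∷ 4F ∷ 0F ∷ 6F ∷ 3F ∷ 5F ∷ []
table k2 k0 k1 k1 k2 k1 = 1F ∷ 2F ∷ 4F ∷ 0F ∷ 6F ∷ 3F ∷ 5F ∷ []
table k2 k0 k1 k1 k2 k2 = 1F ∷ 2F ∷ 4F ∷ 0F ∷ 5F ∷ 3F ∷ 6F ∷ []
table k2 k0 k1 k2 k0 k0 = 2F ∷ 1F ∷ 4F ∷ 0F ∷ 5F ∷ 3F ∷ 6F ∷ []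
table k2 k0 k1 k2 k0 k1 = 2F ∷ 1F ∷ 4F ∷ 0F ∷ 6F ∷ 3F ∷ 5F ∷ []
table k2 k0 k1 k2 k0 k2 = 2F ∷ 1F ∷ 4F ∷ 0F ∷ 6F ∷ 3F ∷ 5F ∷ []
table k2 k0 k1 k2 k1 k0 = 2F ∷ 1F ∷ 3F ∷ 0F ∷ 6F ∷ 4F ∷ 5F ∷ []
table k2 k0 k1 k2 k1 k1 = 2F ∷ 1F ∷ 3F ∷ 0F ∷ 5F ∷ 4F ∷ 6F ∷ []
table k2 k0 k1 k2 k1 k2 = 2F ∷ 1F ∷ 3F ∷ 0F ∷ 6F ∷ 4F ∷ 5F ∷ []
table k2 k0 k1 k2 k2 k0 = 2F ∷ 1F ∷ 3F ∷ 0F ∷ 5F ∷ 4F ∷ 6F ∷ []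
table k2 k0 k1 k2 k2 k1 = 2F ∷ 1F ∷ 3F ∷ 0F ∷ 6F ∷ 4F ∷ 5F ∷ []
table k2 k0 k1 k2 k2 k2 = 2F ∷ 1F ∷ 3F ∷ 0F ∷ 6F ∷ 4F ∷ 5F ∷ []
table k2 k0 k2 k0 k0 k0 = 2F ∷ 1F ∷ 3F ∷ 0F ∷ 4F ∷ 5F ∷ 6F ∷ []
table k2 k0 k2 k0 k0 k1 = 2F ∷ 1F ∷ 3F ∷ 0F ∷ 4F ∷ 5F ∷ 6F ∷ []
table k2 k0 k2 k0 k0 k2 = 2F ∷ 1F ∷ 3F ∷ 0F ∷ 4F ∷ 5F ∷ 6F ∷ []
table k2 k0 k2 k0 k1 k0 = 2F ∷ 1F ∷ 3F ∷ 0F ∷ 4F ∷ 5F ∷ 6F ∷ []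
table k2 k0 k2 k0 k1 k1 = 2F ∷ 1F ∷ 3F ∷ 0F ∷ 4F ∷ 6F ∷ 5F ∷ []
table k2 k0 k2 k0 k1 k2 = 2F ∷ 1F ∷ 3F ∷ 0F ∷ 4F ∷ 5F ∷ 6F ∷ []
table k2 k0 k2 k0 k2 k0 = 2F ∷ 1F ∷ 4F ∷ 0F ∷ 3F ∷ 5F ∷ 6F ∷ []
table k2 k0 k2 k0 k2 k1 = 2F ∷ 1F ∷ 4F ∷ 0F ∷ 3F ∷ 5F ∷ 6F ∷ []
table k2 k0 k2 k0 k2 k2 = 2F ∷ 1F ∷ 4F ∷ 0F ∷ 3F ∷ 5F ∷ 6F ∷ []
table k2 k0 k2 k1 k0 k0 = 1F ∷ 2F ∷ 4F ∷ 0F ∷ 3F ∷ 6F ∷ 5F ∷ []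
table k2 k0 k2 k1 k0 k1 = 1F ∷ 2F ∷ 4F ∷ 0F ∷ 3F ∷ 6F ∷ 5F ∷ []
table k2 k0 k2 k1 k0 k2 = 1F ∷ 2F ∷ 4F ∷ 0F ∷ 3F ∷ 6F ∷ 5F ∷ []
table k2 k0 k2 k1 k1 k0 = 1F ∷ 2F ∷ 3F ∷ 0F ∷ 4F ∷ 6F ∷ 5F ∷ []
table k2 k0 k2 k1 k1 k1 = 1F ∷ 2F ∷ 3F ∷ 0F ∷ 4F ∷ 5F ∷ 6F ∷ []
table k2 k0 k2 k1 k1 k2 = 1F ∷ 2F ∷ 3F ∷ 0F ∷ 4F ∷ 5F ∷ 6F ∷ []
table k2 k0 k2 k1 k2 k0 = 1F ∷ 2F ∷ 3F ∷ 0F ∷ 4F ∷ 5F ∷ 6F ∷ []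
table k2 k0 k2 k1 k2 k1 = 1F ∷ 2F ∷ 3F ∷ 0F ∷ 4F ∷ 6F ∷ 5F ∷ []
table k2 k0 k2 k1 k2 k2 = 1F ∷ 2F ∷ 3F ∷ 0F ∷ 4F ∷ 6F ∷ 5F ∷ []
table k2 k0 k2 k2 k0 k0 = 1F ∷ 2F ∷ 4F ∷ 0F ∷ 3F ∷ 5F ∷ 6F ∷ []
table k2 k0 k2 k2 k0 k1 = 1F ∷ 2F ∷ 4F ∷ 0F ∷ 3F ∷ 5F ∷ 6F ∷ []
table k2 k0 k2 k2 k0 k2 = 1F ∷ 2F ∷ 4F ∷ 0F ∷ 3F ∷ 5F ∷ 6F ∷ []
table k2 k0 k2 k2 k1 k0 = 1F ∷ 2F ∷ 4F ∷ 0F ∷ 3F ∷ 6F ∷ 5F ∷ []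
table k2 k0 k2 k2 k1 k1 = 1F ∷ 2F ∷ 4F ∷ 0F ∷ 3F ∷ 5F ∷ 6F ∷ []
table k2 k0 k2 k2 k1 k2 = 1F ∷ 2F ∷ 4F ∷ 0F ∷ 3F ∷ 6F ∷ 5F ∷ []
table k2 k0 k2 k2 k2 k0 = 1F ∷ 2F ∷ 4F ∷ 0F ∷ 3F ∷ 5F ∷ 6F ∷ []
table k2 k0 k2 k2 k2 k1 = 1F ∷ 2F ∷ 4F ∷ 0F ∷ 3F ∷ 6F ∷ 5F ∷ []
table k2 k0 k2 k2 k2 k2 = 1F ∷ 2F ∷ 4F ∷ 0F ∷ 3F ∷ 6F ∷ 5F ∷ []
table k2 k1 k0 k0 k0 k0 = 1F ∷ 0F ∷ 3F ∷ 2F ∷ 4F ∷ 6F ∷ 5F ∷ []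
table k2 k1 k0 k0 k0 k1 = 1F ∷ 0F ∷ 3F ∷ 2F ∷ 4F ∷ 6F ∷ 5F ∷ []
table k2 k1 k0 k0 k0 k2 = 1F ∷ 0F ∷ 3F ∷ 2F ∷ 4F ∷ 5F ∷ 6F ∷ []
table k2 k1 k0 k0 k1 k0 = 1F ∷ 0F ∷ 3F ∷ 2F ∷ 4F ∷ 5F ∷ 6F ∷ []
table k2 k1 k0 k0 k1 k1 = 1F ∷ 0F ∷ 3F ∷ 2F ∷ 4F ∷ 5F ∷ 6F ∷ []
table k2 k1 k0 k0 k1 k2 = 1F ∷ 0F ∷ 3F ∷ 2F ∷ 4F ∷ 6F ∷ 5F ∷ []
table k2 k1 k0 k0 k2 k0 = 1F ∷ 0F ∷ 4F ∷ 2F ∷ 3F ∷ 6F ∷ 5F ∷ []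
table k2 k1 k0 k0 k2 k1 = 1F ∷ 0F ∷ 4F ∷ 2F ∷ 3F ∷ 6F ∷ 5F ∷ []
table k2 k1 k0 k0 k2 k2 = 1F ∷ 0F ∷ 4F ∷ 2F ∷ 3F ∷ 5F ∷ 6F ∷ []
table k2 k1 k0 k1 k0 k0 = 1F ∷ 0F ∷ 3F ∷ 2F ∷ 4F ∷ 6F ∷ 5F ∷ []
table k2 k1 k0 k1 k0 k1 = 1F ∷ 0F ∷ 3F ∷ 2F ∷ 4F ∷ 5F ∷ 6F ∷ []
table k2 k1 k0 k1 k0 k2 = 1F ∷ 0F ∷ 3F ∷ 2F ∷ 4F ∷ 5F ∷ 6F ∷ []
table k2 k1 k0 k1 k1 k0 = 1F ∷ 0F ∷ 4F ∷ 2F ∷ 3F ∷ 5F ∷ 6F ∷ []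
table k2 k1 k0 k1 k1 k1 = 1F ∷ 0F ∷ 4F ∷ 2F ∷ 3F ∷ 6F ∷ 5F ∷ []
table k2 k1 k0 k1 k1 k2 = 1F ∷ 0F ∷ 4F ∷ 2F ∷ 3F ∷ 6F ∷ 5F ∷ []
table k2 k1 k0 k1 k2 k0 = 1F ∷ 0F ∷ 3F ∷ 2F ∷ 4F ∷ 5F ∷ 6F ∷ []
table k2 k1 k0 k1 k2 k1 = 1F ∷ 0F ∷ 3F ∷ 2F ∷ 4F ∷ 5F ∷ 6F ∷ []
table k2 k1 k0 k1 k2 k2 = 1F ∷ 0F ∷ 3F ∷ 2F ∷ 4F ∷ 6F ∷ 5F ∷ []
table k2 k1 k0 k2 k0 k0 = 2F ∷ 0F ∷ 3F ∷ 1F ∷ 4F ∷ 6F ∷ 5F ∷ []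
table k2 k1 k0 k2 k0 k1 = 2F ∷ 0F ∷ 3F ∷ 1F ∷ 4F ∷ 6F ∷ 5F ∷ []
table k2 k1 k0 k2 k0 k2 = 2F ∷ 0F ∷ 3F ∷ 1F ∷ 4F ∷ 5F ∷ 6F ∷ []
table k2 k1 k0 k2 k1 k0 = 2F ∷ 0F ∷ 4F ∷ 1F ∷ 3F ∷ 5F ∷ 6F ∷ []
table k2 k1 k0 k2 k1 k1 = 2F ∷ 0F ∷ 4F ∷ 1F ∷ 3F ∷ 6F ∷ 5F ∷ []
table k2 k1 k0 k2 k1 k2 = 2F ∷ 0F ∷ 4F ∷ 1F ∷ 3F ∷ 6F ∷ 5F ∷ []
table k2 k1 k0 k2 k2 k0 = 2F ∷ 0F ∷ 3F ∷ 1F ∷ 4F ∷ 5F ∷ 6F ∷ []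
table k2 k1 k0 k2 k2 k1 = 2F ∷ 0F ∷ 3F ∷ 1F ∷ 4F ∷ 6F ∷ 5F ∷ []
table k2 k1 k0 k2 k2 k2 = 2F ∷ 0F ∷ 3F ∷ 1F ∷ 4F ∷ 5F ∷ 6F ∷ []
table k2 k1 k1 k0 k0 k0 = 2F ∷ 0F ∷ 5F ∷ 1F ∷ 4F ∷ 6F ∷ 3F ∷ []
table k2 k1 k1 k0 k0 k1 = 2F ∷ 0F ∷ 5F ∷ 1F ∷ 4F ∷ 6F ∷ 3F ∷ []
table k2 k1 k1 k0 k0 k2 = 2F ∷ 0F ∷ 6F ∷ 1F ∷ 4F ∷ 5F ∷ 3F ∷ []
table k2 k1 k1 k0 k1 k0 = 2F ∷ 0F ∷ 5F ∷ 1F ∷ 4F ∷ 6F ∷ 3F ∷ []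
table k2 k1 k1 k0 k1 k1 = 2F ∷ 0F ∷ 5F ∷ 1F ∷ 4F ∷ 6F ∷ 3F ∷ []
table k2 k1 k1 k0 k1 k2 = 2F ∷ 0F ∷ 6F ∷ 1F ∷ 4F ∷ 5F ∷ 3F ∷ []
table k2 k1 k1 k0 k2 k0 = 2F ∷ 0F ∷ 5F ∷ 1F ∷ 3F ∷ 6F ∷ 4F ∷ []
table k2 k1 k1 k0 k2 k1 = 2F ∷ 0F ∷ 6F ∷ 1F ∷ 3F ∷ 5F ∷ 4F ∷ []
table k2 k1 k1 k0 k2 k2 = 2F ∷ 0F ∷ 6F ∷ 1F ∷ 3F ∷ 5F ∷ 4F ∷ []
table k2 k1 k1 k1 k0 k0 = 2F ∷ 0F ∷ 6F ∷ 1F ∷ 4F ∷ 5F ∷ 3F ∷ []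
table k2 k1 k1 k1 k0 k1 = 2F ∷ 0F ∷ 5F ∷ 1F ∷ 4F ∷ 6F ∷ 3F ∷ []
table k2 k1 k1 k1 k0 k2 = 2F ∷ 0F ∷ 6F ∷ 1F ∷ 4F ∷ 5F ∷ 3F ∷ []
table k2 k1 k1 k1 k1 k0 = 2F ∷ 0F ∷ 5F ∷ 1F ∷ 4F ∷ 6F ∷ 3F ∷ []
table k2 k1 k1 k1 k1 k1 = 2F ∷ 0F ∷ 6F ∷ 1F ∷ 4F ∷ 5F ∷ 3F ∷ []
table k2 k1 k1 k1 k1 k2 = 2F ∷ 0F ∷ 5F ∷ 1F ∷ 4F ∷ 6F ∷ 3F ∷ []
table k2 k1 k1 k1 k2 k0 = 2F ∷ 0F ∷ 6F ∷ 1F ∷ 3F ∷ 5F ∷ 4F ∷ []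
table k2 k1 k1 k1 k2 k1 = 2F ∷ 0F ∷ 6F ∷ 1F ∷ 3F ∷ 5F ∷ 4F ∷ []
table k2 k1 k1 k1 k2 k2 = 2F ∷ 0F ∷ 5F ∷ 1F ∷ 3F ∷ 6F ∷ 4F ∷ []
table k2 k1 k1 k2 k0 k0 = 1F ∷ 0F ∷ 5F ∷ 2F ∷ 3F ∷ 6F ∷ 4F ∷ []
table k2 k1 k1 k2 k0 k1 = 1F ∷ 0F ∷ 6F ∷ 2F ∷ 3F ∷ 5F ∷ 4F ∷ []
table k2 k1 k1 k2 k0 k2 = 1F ∷ 0F ∷ 6F ∷ 2F ∷ 3F ∷ 5F ∷ 4F ∷ []
table k2 k1 k1 k2 k1 k0 = 1F ∷ 0F ∷ 5F ∷ 2F ∷ 3F ∷ 6F ∷ 4F ∷ []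
table k2 k1 k1 k2 k1 k1 = 1F ∷ 0F ∷ 5F ∷ 2F ∷ 3F ∷ 6F ∷ 4F ∷ []
table k2 k1 k1 k2 k1 k2 = 1F ∷ 0F ∷ 6F ∷ 2F ∷ 3F ∷ 5F ∷ 4F ∷ []
table k2 k1 k1 k2 k2 k0 = 1F ∷ 0F ∷ 5F ∷ 2F ∷ 4F ∷ 6F ∷ 3F ∷ []
table k2 k1 k1 k2 k2 k1 = 1F ∷ 0F ∷ 5F ∷ 2F ∷ 4F ∷ 6F ∷ 3F ∷ []
table k2 k1 k1 k2 k2 k2 = 1F ∷ 0F ∷ 5F ∷ 2F ∷ 4F ∷ 6F ∷ 3F ∷ []
table k2 k1 k2 k0 k0 k0 = 1F ∷ 0F ∷ 3F ∷ 2F ∷ 4F ∷ 5F ∷ 6F ∷ []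
table k2 k1 k2 k0 k0 k1 = 1F ∷ 0F ∷ 3F ∷ 2F ∷ 4F ∷ 6F ∷ 5F ∷ []
table k2 k1 k2 k0 k0 k2 = 1F ∷ 0F ∷ 3F ∷ 2F ∷ 4F ∷ 5F ∷ 6F ∷ []
table k2 k1 k2 k0 k1 k0 = 1F ∷ 0F ∷ 3F ∷ 2F ∷ 4F ∷ 5F ∷ 6F ∷ []
table k2 k1 k2 k0 k1 k1 = 1F ∷ 0F ∷ 3F ∷ 2F ∷ 4F ∷ 5F ∷ 6F ∷ []
table k2 k1 k2 k0 k1 k2 = 1F ∷ 0F ∷ 3F ∷ 2F ∷ 4F ∷ 6F ∷ 5F ∷ []
table k2 k1 k2 k0 k2 k0 = 1F ∷ 0F ∷ 4F ∷ 2F ∷ 3F ∷ 6F ∷ 5F ∷ []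
table k2 k1 k2 k0 k2 k1 = 1F ∷ 0F ∷ 4F ∷ 2F ∷ 3F ∷ 5F ∷ 6F ∷ []
table k2 k1 k2 k0 k2 k2 = 1F ∷ 0F ∷ 4F ∷ 2F ∷ 3F ∷ 5F ∷ 6F ∷ []
table k2 k1 k2 k1 k0 k0 = 1F ∷ 0F ∷ 3F ∷ 2F ∷ 4F ∷ 6F ∷ 5F ∷ []
table k2 k1 k2 k1 k0 k1 = 1F ∷ 0F ∷ 3F ∷ 2F ∷ 4F ∷ 6F ∷ 5F ∷ []
table k2 k1 k2 k1 k0 k2 = 1F ∷ 0F ∷ 3F ∷ 2F ∷ 4F ∷ 6F ∷ 5F ∷ []
table k2 k1 k2 k1 k1 k0 = 1F ∷ 0F ∷ 3F ∷ 2F ∷ 4F ∷ 5F ∷ 6F ∷ []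
table k2 k1 k2 k1 k1 k1 = 1F ∷ 0F ∷ 3F ∷ 2F ∷ 4F ∷ 5F ∷ 6F ∷ []
table k2 k1 k2 k1 k1 k2 = 1F ∷ 0F ∷ 3F ∷ 2F ∷ 4F ∷ 6F ∷ 5F ∷ []
table k2 k1 k2 k1 k2 k0 = 1F ∷ 0F ∷ 4F ∷ 2F ∷ 3F ∷ 5F ∷ 6F ∷ []
table k2 k1 k2 k1 k2 k1 = 1F ∷ 0F ∷ 4F ∷ 2F ∷ 3F ∷ 6F ∷ 5F ∷ []
table k2 k1 k2 k1 k2 k2 = 1F ∷ 0F ∷ 4F ∷ 2F ∷ 3F ∷ 6F ∷ 5F ∷ []
table k2 k1 k2 k2 k0 k0 = 2F ∷ 0F ∷ 3F ∷ 1F ∷ 4F ∷ 5F ∷ 6F ∷ []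
table k2 k1 k2 k2 k0 k1 = 2F ∷ 0F ∷ 3F ∷ 1F ∷ 4F ∷ 6F ∷ 5F ∷ []
table k2 k1 k2 k2 k0 k2 = 2F ∷ 0F ∷ 3F ∷ 1F ∷ 4F ∷ 5F ∷ 6F ∷ []
table k2 k1 k2 k2 k1 k0 = 2F ∷ 0F ∷ 3F ∷ 1F ∷ 4F ∷ 6F ∷ 5F ∷ []
table k2 k1 k2 k2 k1 k1 = 2F ∷ 0F ∷ 3F ∷ 1F ∷ 4F ∷ 6F ∷ 5F ∷ []
table k2 k1 k2 k2 k1 k2 = 2F ∷ 0F ∷ 3F ∷ 1F ∷ 4F ∷ 6F ∷ 5F ∷ []
table k2 k1 k2 k2 k2 k0 = 2F ∷ 0F ∷ 3F ∷ 1F ∷ 4F ∷ 6F ∷ 5F ∷ []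
table k2 k1 k2 k2 k2 k1 = 2F ∷ 0F ∷ 3F ∷ 1F ∷ 4F ∷ 5F ∷ 6F ∷ []
table k2 k1 k2 k2 k2 k2 = 2F ∷ 0F ∷ 3F ∷ 1F ∷ 4F ∷ 5F ∷ 6F ∷ []
table k2 k2 k0 k0 k0 k0 = 0F ∷ 1F ∷ 5F ∷ 2F ∷ 4F ∷ 3F ∷ 6F ∷ []
table k2 k2 k0 k0 k0 k1 = 0F ∷ 1F ∷ 6F ∷ 2F ∷ 4F ∷ 3F ∷ 5F ∷ []
table k2 k2 k0 k0 k0 k2 = 0F ∷ 1F ∷ 6F ∷ 2F ∷ 4F ∷ 3F ∷ 5F ∷ []
table k2 k2 k0 k0 k1 k0 = 0F ∷ 1F ∷ 5F ∷ 2F ∷ 3F ∷ 4F ∷ 6F ∷ []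
table k2 k2 k0 k0 k1 k1 = 0F ∷ 1F ∷ 5F ∷ 2F ∷ 3F ∷ 4F ∷ 6F ∷ []
table k2 k2 k0 k0 k1 k2 = 0F ∷ 1F ∷ 5F ∷ 2F ∷ 3F ∷ 4F ∷ 6F ∷ []
table k2 k2 k0 k0 k2 k0 = 0F ∷ 1F ∷ 5F ∷ 2F ∷ 4F ∷ 3F ∷ 6F ∷ []
table k2 k2 k0 k0 k2 k1 = 0F ∷ 1F ∷ 6F ∷ 2F ∷ 4F ∷ 3F ∷ 5F ∷ []
table k2 k2 k0 k0 k2 k2 = 0F ∷ 1F ∷ 5F ∷ 2F ∷ 4F ∷ 3F ∷ 6F ∷ []
table k2 k2 k0 k1 k0 k0 = 0F ∷ 2F ∷ 5F ∷ 1F ∷ 3F ∷ 4F ∷ 6F ∷ []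
table k2 k2 k0 k1 k0 k1 = 0F ∷ 2F ∷ 6F ∷ 1F ∷ 3F ∷ 4F ∷ 5F ∷ []
table k2 k2 k0 k1 k0 k2 = 0F ∷ 2F ∷ 6F ∷ 1F ∷ 3F ∷ 4F ∷ 5F ∷ []
table k2 k2 k0 k1 k1 k0 = 0F ∷ 2F ∷ 6F ∷ 1F ∷ 4F ∷ 3F ∷ 5F ∷ []
table k2 k2 k0 k1 k1 k1 = 0F ∷ 2F ∷ 5F ∷ 1F ∷ 4F ∷ 3F ∷ 6F ∷ []
table k2 k2 k0 k1 k1 k2 = 0F ∷ 2F ∷ 6F ∷ 1F ∷ 4F ∷ 3F ∷ 5F ∷ []
table k2 k2 k0 k1 k2 k0 = 0F ∷ 2F ∷ 6F ∷ 1F ∷ 3F ∷ 4F ∷ 5F ∷ []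
table k2 k2 k0 k1 k2 k1 = 0F ∷ 2F ∷ 6F ∷ 1F ∷ 3F ∷ 4F ∷ 5F ∷ []
table k2 k2 k0 k1 k2 k2 = 0F ∷ 2F ∷ 5F ∷ 1F ∷ 3F ∷ 4F ∷ 6F ∷ []
table k2 k2 k0 k2 k0 k0 = 0F ∷ 1F ∷ 6F ∷ 2F ∷ 3F ∷ 4F ∷ 5F ∷ []
table k2 k2 k0 k2 k0 k1 = 0F ∷ 1F ∷ 5F ∷ 2F ∷ 3F ∷ 4F ∷ 6F ∷ []
table k2 k2 k0 k2 k0 k2 = 0F ∷ 1F ∷ 5F ∷ 2F ∷ 3F ∷ 4F ∷ 6F ∷ []
table k2 k2 k0 k2 k1 k0 = 0F ∷ 1F ∷ 5F ∷ 2F ∷ 3F ∷ 4F ∷ 6F ∷ []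
table k2 k2 k0 k2 k1 k1 = 0F ∷ 1F ∷ 6F ∷ 2F ∷ 3F ∷ 4F ∷ 5F ∷ []
table k2 k2 k0 k2 k1 k2 = 0F ∷ 1F ∷ 5F ∷ 2F ∷ 3F ∷ 4F ∷ 6F ∷ []
table k2 k2 k0 k2 k2 k0 = 0F ∷ 1F ∷ 5F ∷ 2F ∷ 4F ∷ 3F ∷ 6F ∷ []
table k2 k2 k0 k2 k2 k1 = 0F ∷ 1F ∷ 6F ∷ 2F ∷ 4F ∷ 3F ∷ 5F ∷ []
table k2 k2 k0 k2 k2 k2 = 0F ∷ 1F ∷ 5F ∷ 2F ∷ 4F ∷ 3F ∷ 6F ∷ []
table k2 k2 k1 k0 k0 k0 = 0F ∷ 2F ∷ 6F ∷ 1F ∷ 5F ∷ 3F ∷ 4F ∷ []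
table k2 k2 k1 k0 k0 k1 = 0F ∷ 2F ∷ 6F ∷ 1F ∷ 5F ∷ 3F ∷ 4F ∷ []
table k2 k2 k1 k0 k0 k2 = 0F ∷ 2F ∷ 6F ∷ 1F ∷ 5F ∷ 3F ∷ 4F ∷ []
table k2 k2 k1 k0 k1 k0 = 0F ∷ 2F ∷ 6F ∷ 1F ∷ 5F ∷ 4F ∷ 3F ∷ []
table k2 k2 k1 k0 k1 k1 = 0F ∷ 2F ∷ 5F ∷ 1F ∷ 6F ∷ 4F ∷ 3F ∷ []
table k2 k2 k1 k0 k1 k2 = 0F ∷ 2F ∷ 6F ∷ 1F ∷ 5F ∷ 4F ∷ 3F ∷ []
table k2 k2 k1 k0 k2 k0 = 0F ∷ 2F ∷ 5F ∷ 1F ∷ 6F ∷ 4F ∷ 3F ∷ []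
table k2 k2 k1 k0 k2 k1 = 0F ∷ 2F ∷ 5F ∷ 1F ∷ 6F ∷ 4F ∷ 3F ∷ []
table k2 k2 k1 k0 k2 k2 = 0F ∷ 2F ∷ 5F ∷ 1F ∷ 6F ∷ 4F ∷ 3F ∷ []
table k2 k2 k1 k1 k0 k0 = 0F ∷ 1F ∷ 6F ∷ 2F ∷ 5F ∷ 3F ∷ 4F ∷ []
table k2 k2 k1 k1 k0 k1 = 0F ∷ 1F ∷ 5F ∷ 2F ∷ 6F ∷ 3F ∷ 4F ∷ []
table k2 k2 k1 k1 k0 k2 = 0F ∷ 1F ∷ 5F ∷ 2F ∷ 6F ∷ 3F ∷ 4F ∷ []
table k2 k2 k1 k1 k1 k0 = 0F ∷ 1F ∷ 5F ∷ 2F ∷ 6F ∷ 4F ∷ 3F ∷ []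
table k2 k2 k1 k1 k1 k1 = 0F ∷ 1F ∷ 6F ∷ 2F ∷ 5F ∷ 4F ∷ 3F ∷ []
table k2 k2 k1 k1 k1 k2 = 0F ∷ 1F ∷ 6F ∷ 2F ∷ 5F ∷ 4F ∷ 3F ∷ []
table k2 k2 k1 k1 k2 k0 = 0F ∷ 1F ∷ 6F ∷ 2F ∷ 5F ∷ 3F ∷ 4F ∷ []
table k2 k2 k1 k1 k2 k1 = 0F ∷ 1F ∷ 6F ∷ 2F ∷ 5F ∷ 3F ∷ 4F ∷ []
table k2 k2 k1 k1 k2 k2 = 0F ∷ 1F ∷ 6F ∷ 2F ∷ 5F ∷ 3F ∷ 4F ∷ []
table k2 k2 k1 k2 k0 k0 = 0F ∷ 1F ∷ 6F ∷ 2F ∷ 5F ∷ 4F ∷ 3F ∷ []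
table k2 k2 k1 k2 k0 k1 = 0F ∷ 1F ∷ 6F ∷ 2F ∷ 5F ∷ 4F ∷ 3F ∷ []
table k2 k2 k1 k2 k0 k2 = 0F ∷ 1F ∷ 6F ∷ 2F ∷ 5F ∷ 4F ∷ 3F ∷ []
table k2 k2 k1 k2 k1 k0 = 0F ∷ 1F ∷ 5F ∷ 2F ∷ 6F ∷ 4F ∷ 3F ∷ []
table k2 k2 k1 k2 k1 k1 = 0F ∷ 1F ∷ 5F ∷ 2F ∷ 6F ∷ 4F ∷ 3F ∷ []
table k2 k2 k1 k2 k1 k2 = 0F ∷ 1F ∷ 5F ∷ 2F ∷ 6F ∷ 4F ∷ 3F ∷ []
table k2 k2 k1 k2 k2 k0 = 0F ∷ 1F ∷ 5F ∷ 2F ∷ 6F ∷ 4F ∷ 3F ∷ []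
table k2 k2 k1 k2 k2 k1 = 0F ∷ 1F ∷ 6F ∷ 2F ∷ 5F ∷ 4F ∷ 3F ∷ []
table k2 k2 k1 k2 k2 k2 = 0F ∷ 1F ∷ 5F ∷ 2F ∷ 6F ∷ 4F ∷ 3F ∷ []
table k2 k2 k2 k0 k0 k0 = 0F ∷ 1F ∷ 5F ∷ 2F ∷ 3F ∷ 4F ∷ 6F ∷ []
table k2 k2 k2 k0 k0 k1 = 0F ∷ 1F ∷ 6F ∷ 2F ∷ 3F ∷ 4F ∷ 5F ∷ []
table k2 k2 k2 k0 k0 k2 = 0F ∷ 1F ∷ 6F ∷ 2F ∷ 3F ∷ 4F ∷ 5F ∷ []
table k2 k2 k2 k0 k1 k0 = 0F ∷ 1F ∷ 6F ∷ 2F ∷ 4F ∷ 3F ∷ 5F ∷ []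
table k2 k2 k2 k0 k1 k1 = 0F ∷ 1F ∷ 6F ∷ 2F ∷ 4F ∷ 3F ∷ 5F ∷ []
table k2 k2 k2 k0 k1 k2 = 0F ∷ 1F ∷ 5F ∷ 2F ∷ 4F ∷ 3F ∷ 6F ∷ []
table k2 k2 k2 k0 k2 k0 = 0F ∷ 1F ∷ 5F ∷ 2F ∷ 3F ∷ 4F ∷ 6F ∷ []
table k2 k2 k2 k0 k2 k1 = 0F ∷ 1F ∷ 5F ∷ 2F ∷ 3F ∷ 4F ∷ 6F ∷ []
table k2 k2 k2 k0 k2 k2 = 0F ∷ 1F ∷ 6F ∷ 2F ∷ 3F ∷ 4F ∷ 5F ∷ []
table k2 k2 k2 k1 k0 k0 = 0F ∷ 1F ∷ 5F ∷ 2F ∷ 4F ∷ 3F ∷ 6F ∷ []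
table k2 k2 k2 k1 k0 k1 = 0F ∷ 1F ∷ 6F ∷ 2F ∷ 4F ∷ 3F ∷ 5F ∷ []
table k2 k2 k2 k1 k0 k2 = 0F ∷ 1F ∷ 6F ∷ 2F ∷ 4F ∷ 3F ∷ 5F ∷ []
table k2 k2 k2 k1 k1 k0 = 0F ∷ 1F ∷ 5F ∷ 2F ∷ 3F ∷ 4F ∷ 6F ∷ []
table k2 k2 k2 k1 k1 k1 = 0F ∷ 1F ∷ 5F ∷ 2F ∷ 3F ∷ 4F ∷ 6F ∷ []
table k2 k2 k2 k1 k1 k2 = 0F ∷ 1F ∷ 5F ∷ 2F ∷ 3F ∷ 4F ∷ 6F ∷ []
table k2 k2 k2 k1 k2 k0 = 0F ∷ 1F ∷ 6F ∷ 2F ∷ 3F ∷ 4F ∷ 5F ∷ []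
table k2 k2 k2 k1 k2 k1 = 0F ∷ 1F ∷ 6F ∷ 2F ∷ 3F ∷ 4F ∷ 5F ∷ []
table k2 k2 k2 k1 k2 k2 = 0F ∷ 1F ∷ 5F ∷ 2F ∷ 3F ∷ 4F ∷ 6F ∷ []
table k2 k2 k2 k2 k0 k0 = 0F ∷ 2F ∷ 5F ∷ 1F ∷ 4F ∷ 3F ∷ 6F ∷ []
table k2 k2 k2 k2 k0 k1 = 0F ∷ 2F ∷ 5F ∷ 1F ∷ 4F ∷ 3F ∷ 6F ∷ []
table k2 k2 k2 k2 k0 k2 = 0F ∷ 2F ∷ 5F ∷ 1F ∷ 4F ∷ 3F ∷ 6F ∷ []
table k2 k2 k2 k2 k1 k0 = 0F ∷ 2F ∷ 5F ∷ 1F ∷ 4F ∷ 3F ∷ 6F ∷ []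
table k2 k2 k2 k2 k1 k1 = 0F ∷ 2F ∷ 5F ∷ 1F ∷ 4F ∷ 3F ∷ 6F ∷ []
table k2 k2 k2 k2 k1 k2 = 0F ∷ 2F ∷ 6F ∷ 1F ∷ 4F ∷ 3F ∷ 5F ∷ []
table k2 k2 k2 k2 k2 k0 = 0F ∷ 2F ∷ 5F ∷ 1F ∷ 4F ∷ 3F ∷ 6F ∷ []
table k2 k2 k2 k2 k2 k1 = 0F ∷ 2F ∷ 6F ∷ 1F ∷ 4F ∷ 3F ∷ 5F ∷ []
table k2 k2 k2 k2 k2 k2 = 0F ∷ 2F ∷ 6F ∷ 1F ∷ 4F ∷ 3F ∷ 5F ∷ []

directions : Kinds 6 → Vec (Fin 7) 7
directions ((((((_ , κ₁) , κ₂) , κ₃) , κ₄) , κ₅) , κ₆) = table κ₁ κ₂ κ₃ κ₄ κ₅ κ₆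

rule₇ : Fin 7 → Kinds 7 → Fin 7
rule₇ c (q , _) = lookup (directions q) c

rule₇-triangular : ∀ c → IsTriangular rows₇ (rule₇ c)
rule₇-triangular c = triangularᵇ-sound rows₇ (rule₇ c) (allFin-sound 7 (λ c → triangularᵇ rows₇ (rule₇ c)) tt c)

rule₇-powerOfTwoWeights : ∀ c → PowerOfTwoWeights (triangularise rows₇ (rule₇ c))
rule₇-powerOfTwoWeights c = toWitness {a? = powerOfTwoWeights? (triangularise rows₇ (rule₇ c))}
  (allFin-sound 7 (λ c → isYes (powerOfTwoWeights? (triangularise rows₇ (rule₇ c)))) tt c)

rule₇-injective : ∀ q → Injective _≡_ _≡_ (λ c → rule₇ c q)
rule₇-injective (q , _) =
  injectiveᵇ-sound (lookup (directions q)) (allKinds-sound 6 (injectiveᵇ ∘ lookup ∘ directions) tt q)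

rule₇-admissible : ∀ m′ → (2 + m′) % 2 ≡ 1 → ∀ c → Orbits.Admissible m′ (triangularise rows₇ (rule₇ c))
rule₇-admissible m′ odd c = Orbits.powerOfTwoWeights⇒admissible m′ (Residues.odd⇒coprime-2 m′ odd)
  (triangularise rows₇ (rule₇ c)) (rule₇-powerOfTwoWeights c)

theorem1p1 : (m : ℕ) → 3 ≤ m → m % 2 ≡ 1 → HamiltonDecomposition m 7
theorem1p1 zero           ()       _
theorem1p1 (suc zero)     (s≤s ()) _
theorem1p1 (suc (suc m′)) _        odd =
  Walks.hamiltonDecomposition m′ rows₇ rule₇ rule₇-triangular (rule₇-admissible m′ odd) rule₇-injective
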